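{- For all integers $n>0$ and $k>0$, \[ |\mathcal{C}_n^k|=\sum_{j=0}^{k}\left\langle k\atop j\right\rangle\sum_{m=0}^{k+2-j}\binom{k+2-j}{m}(m+j-1)!\,{n\brace m+j-1}=B_{n,k}. \]
   Context: A Callan permutation of $[n+k]=\{1,2,\ldots,n+k\}$ is a permutation (written as a word $\pi_1\pi_2\cdots\pi_{n+k}$) such that every substring of consecutive entries all of whose entries lie in $N=\{1,\ldots,n\}$, or all of whose entries lie in $K=\{n+1,\ldots,n+k\}$, is increasing. $\mathcal{C}_n^k$ denotes the set of Callan permutations of $[n+k]$. The poly-Bernoulli numbers are defined by $\sum_{n\ge 0}B_n^{(k)}\frac{x^n}{n!}=\frac{\mathrm{Li}_k(1-e^{ -x})}{1-e^{ -x}}$ with $\mathrm{Li}_k(z)=\sum_{i\ge1} z^i/i^k$, and $B_{n,k}:=B_n^{(-k)}$. The Eulerian number $\left\langle k\atop j\right\rangle$ is the number of permutations of $[k]$ with exactly $j-1$ descents (equivalently, with $j$ maximal ascending runs); in particular $\left\langle k\atop 0\right\rangle=0$ for $k>0$. ${n\brace r}$ denotes the Stirling number of the second kind (number of partitions of an $n$-element set into $r$ nonempty blocks), with ${n\brace r}=0$ for $r<0$, $r=0<n$, or $r>n$. -}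

module Defs where

open import Data.Nat using (ℕ; zero; suc; _!; _+_; _*_; _∸_; _^_; _≤_; _<_; _<ᵇ_; _≟_)
open import Data.Nat.Combinatorics using (_C_)
open import Data.Bool using (if_then_else_)
open import Data.Integer as ℤ using (ℤ; +_)
open import Data.List using (List; []; _∷_; _++_; map; upTo; length; filter; concatMap; foldr)
open import Data.List.Relation.Unary.All using (All)
open import Data.List.Relation.Unary.Linked using (Linked)
open import Data.List.Relation.Binary.Permutation.Propositional using (_↭_)
open import Data.Sum using (_⊎_)
open import Data.Product using (_×_)
open import Relation.Binary.PropositionalEquality using (_≡_)

sumTo : ℕ → (ℕ → ℕ) → ℕ
sumTo n f = foldr (λ i acc → f i + acc) 0 (upTo (suc n))

sumToℤ : ℕ → (ℕ → ℤ) → ℤ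
sumToℤ n f = foldr (λ i acc → f i ℤ.+ acc) (+ 0) (upTo (suc n))

range1 : ℕ → List ℕ
range1 a = map suc (upTo a)

IsCallan : ℕ → ℕ → List ℕ → Set
IsCallan n k π =
  (π ↭ range1 (n + k)) ×
  (∀ (xs ys zs : List ℕ) → π ≡ xs ++ ys ++ zs →
     (All (λ x → x ≤ n) ys ⊎ All (λ x → n < x) ys) →
     Linked _<_ ys)

insertions : ℕ → List ℕ → List (List ℕ)
insertions x []       = (x ∷ []) ∷ []
insertions x (y ∷ ys) = (x ∷ y ∷ ys) ∷ map (y ∷_) (insertions x ys)

perms : List ℕ → List (List ℕ)
perms []       = [] ∷ []
perms (x ∷ xs) = concatMap (insertions x) (perms xs)

descents : List ℕ → ℕ
descents (x ∷ y ∷ ys) = (if y <ᵇ x then 1 else 0) + descents (y ∷ ys)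
descents _            = 0

runs : List ℕ → ℕ
runs []       = 0
runs (x ∷ xs) = suc (descents (x ∷ xs))

-- Eulerian number ⟨k j⟩: number of permutations of [k] with exactly
-- j maximal ascending runs (so ⟨0 0⟩ = 1, ⟨k 0⟩ = 0 for k > 0).
eulerian : ℕ → ℕ → ℕ
eulerian k j = length (filter (λ π → runs π ≟ j) (perms (range1 k)))

stirling2 : ℕ → ℕ → ℕ
stirling2 zero    zero    = 1
stirling2 zero    (suc r) = 0
stirling2 (suc n) zero    = 0
stirling2 (suc n) (suc r) = suc r * stirling2 n (suc r) + stirling2 n r

-- (s-1)! {n brace s-1}, with value 0 when s-1 = -1  ({n brace -1} = 0)
facStirShift : ℕ → ℕ → ℕ
facStirShift n zero    = 0
facStirShift n (suc r) = (r !) * stirling2 n r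

middleSum : ℕ → ℕ → ℕ
middleSum n k =
  sumTo k (λ j → eulerian k j *
    sumTo (k + 2 ∸ j) (λ m → ((k + 2 ∸ j) C m) * facStirShift n (m + j)))

-- Poly-Bernoulli numbers B_{n,k} = B_n^{(-k)}.
-- Exponential generating functions are represented by their sequence of
-- EGF coefficients a : ℕ → ℤ  (series Σ a_n x^n / n!).

EGF : Set
EGF = ℕ → ℤ

egfMul : EGF → EGF → EGF
egfMul f g n = sumToℤ n (λ j → + (n C j) ℤ.* (f j ℤ.* g (n ∸ j)))

egfOne : EGF
egfOne zero    = + 1
egfOne (suc n) = + 0

oneMinusExpNeg : EGF
oneMinusExpNeg zero    = + 0
oneMinusExpNeg (suc m) = (ℤ.- (+ 1)) ℤ.^ m

egfPow : EGF → ℕ → EGF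
egfPow f zero    = egfOne
egfPow f (suc i) = egfMul f (egfPow f i)

-- Li_{-k}(z)/z = Σ_{i≥1} i^k z^{i-1} with z = 1 - e^{-x}.  Since
-- (1-e^{-x})^{i-1} = x^{i-1} + ..., only i ≤ n+1 contribute to x^n,
-- so the coefficient n![x^n] is the finite sum below.
polyBernoulli : ℕ → ℕ → ℤ
polyBernoulli n k =
  sumToℤ n (λ i → + (suc i ^ k) ℤ.* egfPow oneMinusExpNeg i n)

module Submission where

-- Write s_k(r) = r! S(k,r) for the number of surjections [k] → [r]. A Callan permutation
-- is an alternation of nonempty increasing runs of letters from N and from K, so choosing
-- it amounts to two ordered set partitions, of N into r blocks and of K into r - 1, r or
-- r + 1 blocks; hence |C_n^k| = Σ_r s_n(r) (s_k(r-1) + 2 s_k(r) + s_k(r+1)).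
-- The Eulerian sum takes the same value: grouping the permutations w of [k] by their
-- descents and ascents, the Worpitzky-type identity Σ_w C(asc w, s - 1 - des w) = s_k(s)
-- collapses it. So does B_{n,k} = Σ_i (i+1)^k n![x^n] (1 - e^{-x})^i: writing
-- (i+1)^k = Σ_r C(i,r) (s_k(r) + s_k(r+1)), both sides satisfy the same recurrence in n.

open import Defs
open import Data.Nat using (ℕ)

module Summation where

  open import Data.Nat as ℕ using (ℕ; zero; suc; _≤_; _<_; _∸_; z≤n; s≤s)
  open import Data.Nat.Properties using (m+[n∸m]≡n; m≤m+n)
  open import Data.List using (List; []; _∷_; _++_; map; concatMap; concat; foldr; applyUpTo)
  open import Function using (_∘_)
  open import Data.List.Relation.Unary.All using (All; []; _∷_)
  open import Relation.Binary.PropositionalEquality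
  open ≡-Reasoning

  module Sums {A : Set} (0# : A) (_+_ : A → A → A)
    (+-identityˡ : ∀ x → 0# + x ≡ x)
    (+-assoc : ∀ x y z → (x + y) + z ≡ x + (y + z))
    (+-comm : ∀ x y → x + y ≡ y + x) where

    private
      +-identityʳ : ∀ x → x + 0# ≡ x
      +-identityʳ x = trans (+-comm x 0#) (+-identityˡ x)

      interchange : ∀ a b c d → (a + b) + (c + d) ≡ (a + c) + (b + d)
      interchange a b c d = begin
        (a + b) + (c + d) ≡⟨ +-assoc a b (c + d) ⟩
        a + (b + (c + d)) ≡⟨ cong (a +_) (sym (+-assoc b c d)) ⟩
        a + ((b + c) + d) ≡⟨ cong (λ z → a + (z + d)) (+-comm b c) ⟩
        a + ((c + b) + d) ≡⟨ cong (a +_) (+-assoc c b d) ⟩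
        a + (c + (b + d)) ≡⟨ sym (+-assoc a c (b + d)) ⟩
        (a + c) + (b + d) ∎

    Σ< : ℕ → (ℕ → A) → A
    Σ< zero    f = 0#
    Σ< (suc n) f = f 0 + Σ< n (λ i → f (suc i))

    Σ<-cong : ∀ n {f g} → (∀ i → f i ≡ g i) → Σ< n f ≡ Σ< n g
    Σ<-cong zero    eq = refl
    Σ<-cong (suc n) eq = cong₂ _+_ (eq 0) (Σ<-cong n (λ i → eq (suc i)))

    Σ<-cong< : ∀ n {f g} → (∀ i → i < n → f i ≡ g i) → Σ< n f ≡ Σ< n g
    Σ<-cong< zero    eq = refl
    Σ<-cong< (suc n) eq = cong₂ _+_ (eq 0 (s≤s z≤n)) (Σ<-cong< n (λ i i<n → eq (suc i) (s≤s i<n)))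

    Σ<-last : ∀ n f → Σ< (suc n) f ≡ Σ< n f + f n
    Σ<-last zero    f = trans (+-identityʳ (f 0)) (sym (+-identityˡ (f 0)))
    Σ<-last (suc n) f = begin
      f 0 + Σ< (suc n) (λ i → f (suc i))         ≡⟨ cong (f 0 +_) (Σ<-last n (λ i → f (suc i))) ⟩
      f 0 + (Σ< n (λ i → f (suc i)) + f (suc n)) ≡⟨ sym (+-assoc _ _ _) ⟩
      Σ< (suc n) f + f (suc n)                   ∎

    Σ<-+ : ∀ n f g → Σ< n (λ i → f i + g i) ≡ Σ< n f + Σ< n g
    Σ<-+ zero    f g = sym (+-identityˡ 0#)
    Σ<-+ (suc n) f g = trans (cong ((f 0 + g 0) +_) (Σ<-+ n _ _)) (interchange _ _ _ _)

    Σ<-0 : ∀ n → Σ< n (λ _ → 0#) ≡ 0#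
    Σ<-0 zero    = refl
    Σ<-0 (suc n) = trans (+-identityˡ _) (Σ<-0 n)

    Σ<-vanish : ∀ n f → (∀ i → i < n → f i ≡ 0#) → Σ< n f ≡ 0#
    Σ<-vanish n f eq = trans (Σ<-cong< n eq) (Σ<-0 n)

    Σ<-split : ∀ m n f → Σ< (m ℕ.+ n) f ≡ Σ< m f + Σ< n (λ i → f (m ℕ.+ i))
    Σ<-split zero    n f = sym (+-identityˡ _)
    Σ<-split (suc m) n f = trans (cong (f 0 +_) (Σ<-split m n (λ i → f (suc i)))) (sym (+-assoc _ _ _))

    Σ<-truncate : ∀ m M f → m ≤ M → (∀ i → m ≤ i → f i ≡ 0#) → Σ< M f ≡ Σ< m f
    Σ<-truncate m M f m≤M tail = begin
      Σ< M f                                  ≡⟨ cong (λ t → Σ< t f) (sym (m+[n∸m]≡n m≤M)) ⟩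
      Σ< (m ℕ.+ (M ∸ m)) f                    ≡⟨ Σ<-split m (M ∸ m) f ⟩
      Σ< m f + Σ< (M ∸ m) (λ i → f (m ℕ.+ i)) ≡⟨ cong (Σ< m f +_) (Σ<-vanish (M ∸ m) _ (λ i _ → tail (m ℕ.+ i) (m≤m+n m i))) ⟩
      Σ< m f + 0#                             ≡⟨ +-identityʳ _ ⟩
      Σ< m f                                  ∎

    Σ<-swap : ∀ m n (f : ℕ → ℕ → A) → Σ< m (λ i → Σ< n (f i)) ≡ Σ< n (λ j → Σ< m (λ i → f i j))
    Σ<-swap zero    n f = sym (Σ<-0 n)
    Σ<-swap (suc m) n f = begin
      Σ< n (f 0) + Σ< m (λ i → Σ< n (f (suc i)))         ≡⟨ cong (Σ< n (f 0) +_) (Σ<-swap m n (λ i → f (suc i))) ⟩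
      Σ< n (f 0) + Σ< n (λ j → Σ< m (λ i → f (suc i) j)) ≡⟨ sym (Σ<-+ n _ _) ⟩
      Σ< n (λ j → Σ< (suc m) (λ i → f i j))              ∎

    foldr-applyUpTo : ∀ (f : ℕ → A) g m → foldr (λ i acc → f i + acc) 0# (applyUpTo g m) ≡ Σ< m (f ∘ g)
    foldr-applyUpTo f g zero    = refl
    foldr-applyUpTo f g (suc m) = cong (f (g 0) +_) (foldr-applyUpTo f (g ∘ suc) m)

    Σ∈ : {B : Set} → List B → (B → A) → A
    Σ∈ []       f = 0#
    Σ∈ (x ∷ xs) f = f x + Σ∈ xs f

    Σ∈-cong : {B : Set} (xs : List B) {f g : B → A} → (∀ x → f x ≡ g x) → Σ∈ xs f ≡ Σ∈ xs g
    Σ∈-cong []       eq = refl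
    Σ∈-cong (x ∷ xs) eq = cong₂ _+_ (eq x) (Σ∈-cong xs eq)

    Σ∈-congAll : {B : Set} {xs : List B} {f g : B → A} → All (λ x → f x ≡ g x) xs → Σ∈ xs f ≡ Σ∈ xs g
    Σ∈-congAll []       = refl
    Σ∈-congAll (p ∷ ps) = cong₂ _+_ p (Σ∈-congAll ps)

    Σ∈-vanish : {B : Set} (xs : List B) (f : B → A) → (∀ x → f x ≡ 0#) → Σ∈ xs f ≡ 0#
    Σ∈-vanish []       f z = refl
    Σ∈-vanish (x ∷ xs) f z = trans (cong₂ _+_ (z x) (Σ∈-vanish xs f z)) (+-identityˡ 0#)

    Σ∈-++ : {B : Set} (xs ys : List B) (f : B → A) → Σ∈ (xs ++ ys) f ≡ Σ∈ xs f + Σ∈ ys f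
    Σ∈-++ []       ys f = sym (+-identityˡ _)
    Σ∈-++ (x ∷ xs) ys f = trans (cong (f x +_) (Σ∈-++ xs ys f)) (sym (+-assoc _ _ _))

    Σ∈-map : {B C : Set} (g : B → C) (xs : List B) (f : C → A) → Σ∈ (map g xs) f ≡ Σ∈ xs (λ x → f (g x))
    Σ∈-map g []       f = refl
    Σ∈-map g (x ∷ xs) f = cong (f (g x) +_) (Σ∈-map g xs f)

    Σ∈-concatMap : {B C : Set} (g : B → List C) (xs : List B) (f : C → A) →
      Σ∈ (concatMap g xs) f ≡ Σ∈ xs (λ x → Σ∈ (g x) f)
    Σ∈-concatMap g []       f = refl
    Σ∈-concatMap g (x ∷ xs) f =
      trans (Σ∈-++ (g x) (concat (map g xs)) f) (cong (Σ∈ (g x) f +_) (Σ∈-concatMap g xs f))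

    Σ∈-+ : {B : Set} (xs : List B) (f g : B → A) → Σ∈ xs (λ x → f x + g x) ≡ Σ∈ xs f + Σ∈ xs g
    Σ∈-+ []       f g = sym (+-identityˡ 0#)
    Σ∈-+ (x ∷ xs) f g = trans (cong ((f x + g x) +_) (Σ∈-+ xs f g)) (interchange _ _ _ _)

    Σ∈-Σ< : {B : Set} (xs : List B) (n : ℕ) (f : B → ℕ → A) →
      Σ∈ xs (λ x → Σ< n (f x)) ≡ Σ< n (λ i → Σ∈ xs (λ x → f x i))
    Σ∈-Σ< []       n f = sym (Σ<-0 n)
    Σ∈-Σ< (x ∷ xs) n f = trans (cong (Σ< n (f x) +_) (Σ∈-Σ< xs n f)) (sym (Σ<-+ n _ _))

    module Distributive (_*_ : A → A → A)
      (*-distribˡ-+ : ∀ c x y → c * (x + y) ≡ (c * x) + (c * y))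
      (*-zeroʳ : ∀ c → c * 0# ≡ 0#) where

      Σ<-*l : ∀ n c f → c * Σ< n f ≡ Σ< n (λ i → c * f i)
      Σ<-*l zero    c f = *-zeroʳ c
      Σ<-*l (suc n) c f = trans (*-distribˡ-+ c _ _) (cong ((c * f 0) +_) (Σ<-*l n c _))

      Σ∈-*l : {B : Set} (xs : List B) (c : A) (f : B → A) → c * Σ∈ xs f ≡ Σ∈ xs (λ x → c * f x)
      Σ∈-*l []       c f = *-zeroʳ c
      Σ∈-*l (x ∷ xs) c f = trans (*-distribˡ-+ c _ _) (cong ((c * f x) +_) (Σ∈-*l xs c f))

module ℕSums where

  open import Data.Nat using (suc; _+_; _*_)
  open import Data.Nat.Properties using (+-identityˡ; +-assoc; +-comm; *-distribˡ-+; *-zeroʳ)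
  open import Function using (id)
  open import Relation.Binary.PropositionalEquality
  open Summation

  open Sums 0 _+_ +-identityˡ +-assoc +-comm public
  open Distributive _*_ *-distribˡ-+ *-zeroʳ public

  sumTo≡Σ< : ∀ n f → sumTo n f ≡ Σ< (suc n) f
  sumTo≡Σ< n f = foldr-applyUpTo f id (suc n)

module Surjections where

  open import Data.Nat as ℕ using (ℕ; zero; suc; _+_; _*_; _<_; z≤n; s≤s; _!)
  open import Data.Nat.Properties
  open import Data.Nat.Combinatorics using (_C_; nCk+nC[k+1]≡[n+1]C[k+1])
  open import Data.Nat.Solver using (module +-*-Solver)
  open +-*-Solver
  open import Relation.Binary.PropositionalEquality
  open ≡-Reasoning
  open ℕSums

  binom : ℕ → ℕ → ℕ
  binom n       zero    = 1
  binom zero    (suc k) = 0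
  binom (suc n) (suc k) = binom n k + binom n (suc k)

  C≡binom : ∀ n k → n C k ≡ binom n k
  C≡binom n       zero    = refl
  C≡binom zero    (suc k) = refl
  C≡binom (suc n) (suc k) =
    trans (sym (nCk+nC[k+1]≡[n+1]C[k+1] n k)) (cong₂ _+_ (C≡binom n k) (C≡binom n (suc k)))

  binom-vanish : ∀ n k → n < k → binom n k ≡ 0
  binom-vanish zero    (suc k) _         = refl
  binom-vanish (suc n) (suc k) (s≤s n<k) =
    cong₂ _+_ (binom-vanish n k n<k) (binom-vanish n (suc k) (m<n⇒m<1+n n<k))

  binom-diag : ∀ n → binom n n ≡ 1
  binom-diag zero    = refl
  binom-diag (suc n) = cong₂ _+_ (binom-diag n) (binom-vanish n (suc n) (n<1+n n))

  binom-1 : ∀ i → binom i 1 ≡ i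
  binom-1 zero    = refl
  binom-1 (suc i) = cong suc (binom-1 i)

  binom-absorb : ∀ i r → suc r * binom i (suc r) + r * binom i r ≡ i * binom i r
  binom-absorb zero    zero    = refl
  binom-absorb zero    (suc r) = cong₂ _+_ (*-zeroʳ (suc (suc r))) (*-zeroʳ (suc r))
  binom-absorb (suc i) zero    = begin
    (1 + binom i 1) + 0 + 0 ≡⟨ cong (λ z → 1 + z + 0 + 0) (binom-1 i) ⟩
    1 + i + 0 + 0           ≡⟨ solve 1 (λ i → con 1 :+ i :+ con 0 :+ con 0 := (con 1 :+ i) :* con 1) refl i ⟩
    suc i * 1               ∎
  binom-absorb (suc i) (suc r) = begin
    suc (suc r) * (Y + Z) + suc r * (X + Y)
      ≡⟨ solve 5 (λ r X Y Z i → (con 2 :+ r) :* (Y :+ Z) :+ (con 1 :+ r) :* (X :+ Y)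
                := Y :+ X :+ ((con 2 :+ r) :* Z :+ (con 1 :+ r) :* Y) :+ ((con 1 :+ r) :* Y :+ r :* X)) refl r X Y Z i ⟩
    Y + X + (suc (suc r) * Z + suc r * Y) + (suc r * Y + r * X)
      ≡⟨ cong₂ (λ a b → Y + X + a + b) (binom-absorb i (suc r)) (binom-absorb i r) ⟩
    Y + X + i * Y + i * X
      ≡⟨ solve 5 (λ r X Y Z i → Y :+ X :+ i :* Y :+ i :* X := (con 1 :+ i) :* (X :+ Y)) refl r X Y Z i ⟩
    suc i * (X + Y) ∎
    where X = binom i r ; Y = binom i (suc r) ; Z = binom i (suc (suc r))

  -- surj n r = r! S(n,r) counts surjections [n] → [r], i.e. ordered set partitions.
  -- It is opaque so that its recurrence is used only through the lemmas below.
  opaque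
    surj : ℕ → ℕ → ℕ
    surj n r = (r !) * stirling2 n r

  surjPrev : ℕ → ℕ → ℕ
  surjPrev n zero    = 0
  surjPrev n (suc r) = surj n r

  stirling2-vanish : ∀ n r → n < r → stirling2 n r ≡ 0
  stirling2-vanish zero    (suc r) _         = refl
  stirling2-vanish (suc n) (suc r) (s≤s n<r) = begin
    suc r * stirling2 n (suc r) + stirling2 n r
      ≡⟨ cong₂ (λ a b → suc r * a + b) (stirling2-vanish n (suc r) (m<n⇒m<1+n n<r)) (stirling2-vanish n r n<r) ⟩
    suc r * 0 + 0 ≡⟨ cong (_+ 0) (*-zeroʳ (suc r)) ⟩
    0 ∎

  opaque
    unfolding surj

    surj-vanish : ∀ n r → n < r → surj n r ≡ 0
    surj-vanish n r n<r = trans (cong ((r !) *_) (stirling2-vanish n r n<r)) (*-zeroʳ (r !))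

    surj≡ : ∀ n r → surj n r ≡ (r !) * stirling2 n r
    surj≡ n r = refl

    surj-0-0 : surj 0 0 ≡ 1
    surj-0-0 = refl

    surj-suc-0 : ∀ n → surj (suc n) 0 ≡ 0
    surj-suc-0 n = refl

    surj-suc-suc : ∀ n r → surj (suc n) (suc r) ≡ suc r * (surj n (suc r) + surj n r)
    surj-suc-suc n r = solve 4 (λ r f a b → (f :+ r :* f) :* ((con 1 :+ r) :* a :+ b)
                                := (con 1 :+ r) :* ((f :+ r :* f) :* a :+ f :* b))
                        refl r (r !) (stirling2 n (suc r)) (stirling2 n r)

  surj-suc : ∀ n r → surj (suc n) r ≡ r * (surj n r + surjPrev n r)
  surj-suc n zero    = surj-suc-0 n
  surj-suc n (suc r) = surj-suc-suc n r

  surj-0-suc : ∀ r → surj 0 (suc r) ≡ 0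
  surj-0-suc r = surj-vanish 0 (suc r) (s≤s z≤n)

  -- Sort by the set of the i < a points not sent to the last value.
  surj-lastFibre : ∀ a r → surj a (suc r) ≡ Σ< a (λ i → binom a i * surj i r)
  surj-lastFibre zero    r = surj-0-suc r
  surj-lastFibre (suc a) r = sym (begin
    Σ< (suc a) (λ i → binom (suc a) i * surj i r)
      ≡⟨ cong (_+ Σ< a (λ i → binom (suc a) (suc i) * surj (suc i) r)) (*-identityˡ (surj 0 r)) ⟩
    surj 0 r + Σ< a (λ i → (binom a i + binom a (suc i)) * surj (suc i) r)
      ≡⟨ cong (surj 0 r +_) (Σ<-cong a (λ i → *-distribʳ-+ (surj (suc i) r) (binom a i) (binom a (suc i)))) ⟩
    surj 0 r + Σ< a (λ i → binom a i * surj (suc i) r + binom a (suc i) * surj (suc i) r)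
      ≡⟨ cong (surj 0 r +_) (Σ<-+ a _ _) ⟩
    surj 0 r + (P + Q)
      ≡⟨ solve 3 (λ x p q → x :+ (p :+ q) := p :+ (con 1 :* x :+ q)) refl (surj 0 r) P Q ⟩
    P + Σ< (suc a) (λ i → binom a i * surj i r)
      ≡⟨ cong₂ _+_ lastFibre-shift (Σ<-last a _) ⟩
    r * (surj a (suc r) + surj a r) + (Σ< a (λ i → binom a i * surj i r) + binom a a * surj a r)
      ≡⟨ cong₂ (λ u v → r * (surj a (suc r) + surj a r) + (u + v)) (sym (surj-lastFibre a r)) (cong (_* surj a r) (binom-diag a)) ⟩
    r * (surj a (suc r) + surj a r) + (surj a (suc r) + 1 * surj a r)
      ≡⟨ solve 3 (λ r x y → r :* (x :+ y) :+ (x :+ con 1 :* y) := (con 1 :+ r) :* (x :+ y)) refl r (surj a (suc r)) (surj a r) ⟩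
    suc r * (surj a (suc r) + surj a r) ≡⟨ sym (surj-suc-suc a r) ⟩
    surj (suc a) (suc r) ∎)
    where
    P = Σ< a (λ i → binom a i * surj (suc i) r)
    Q = Σ< a (λ i → binom a (suc i) * surj (suc i) r)

    lastFibre-prev : ∀ r → r * Σ< a (λ i → binom a i * surjPrev i r) ≡ r * surj a r
    lastFibre-prev zero    = refl
    lastFibre-prev (suc r) = cong (suc r *_) (sym (surj-lastFibre a r))

    lastFibre-shift : Σ< a (λ i → binom a i * surj (suc i) r) ≡ r * (surj a (suc r) + surj a r)
    lastFibre-shift = begin
      Σ< a (λ i → binom a i * surj (suc i) r)
        ≡⟨ Σ<-cong a (λ i → cong (binom a i *_) (surj-suc i r)) ⟩
      Σ< a (λ i → binom a i * (r * (surj i r + surjPrev i r)))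
        ≡⟨ Σ<-cong a (λ i → solve 4 (λ b r x y → b :* (r :* (x :+ y)) := r :* (b :* x) :+ r :* (b :* y))
                                refl (binom a i) r (surj i r) (surjPrev i r)) ⟩
      Σ< a (λ i → r * (binom a i * surj i r) + r * (binom a i * surjPrev i r))
        ≡⟨ Σ<-+ a _ _ ⟩
      Σ< a (λ i → r * (binom a i * surj i r)) + Σ< a (λ i → r * (binom a i * surjPrev i r))
        ≡⟨ sym (cong₂ _+_ (Σ<-*l a r _) (Σ<-*l a r _)) ⟩
      r * Σ< a (λ i → binom a i * surj i r) + r * Σ< a (λ i → binom a i * surjPrev i r)
        ≡⟨ cong₂ _+_ (cong (r *_) (sym (surj-lastFibre a r))) (lastFibre-prev r) ⟩
      r * surj a (suc r) + r * surj a r ≡⟨ sym (*-distribˡ-+ r _ _) ⟩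
      r * (surj a (suc r) + surj a r) ∎

module AlternatingCounts where

  open import Data.Nat as ℕ using (ℕ; zero; suc; _+_; _*_; _<_; s≤s)
  open import Data.Nat.Properties
  open import Data.Nat.Solver using (module +-*-Solver)
  open +-*-Solver
  open import Relation.Binary.PropositionalEquality
  open ≡-Reasoning
  open ℕSums
  open Surjections

  surjPos : ℕ → ℕ → ℕ
  surjPos n zero    = 0
  surjPos n (suc r) = surj n (suc r)

  -- Words over a set of a small and b large letters made of alternating nonempty
  -- increasing runs, starting with a small run: r small runs and r or r - 1 large ones.
  altCount : ℕ → ℕ → ℕ
  altCount a b = Σ< (suc a) (λ r → surj a r * (surj b r + surjPrev b r))

  surj-vanish* : ∀ n r → n < r → ∀ c → surj n r * c ≡ 0
  surj-vanish* n r n<r c = cong (_* c) (surj-vanish n r n<r)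

  altCount-byLargeRuns : ∀ a b →
    Σ< (suc b) (λ r → surj b r * (surj a (suc r) + surjPos a r)) + surj a 0 * surj b 0 ≡ altCount a b
  altCount-byLargeRuns a b = begin
    Σ< (suc b) (λ r → surj b r * (surj a (suc r) + surjPos a r)) + surj a 0 * surj b 0
      ≡⟨ cong (_+ surj a 0 * surj b 0) (Σ<-truncate (suc b) (suc M) _ (s≤s (m≤n+m b a))
            (λ i le → surj-vanish* b i le (surj a (suc i) + surjPos a i))) ⟨
    Σ< (suc M) (λ r → surj b r * (surj a (suc r) + surjPos a r)) + surj a 0 * surj b 0
      ≡⟨ cong (_+ surj a 0 * surj b 0) (Σ<-cong (suc M) (λ r → *-distribˡ-+ (surj b r) (surj a (suc r)) (surjPos a r))) ⟩
    Σ< (suc M) (λ r → surj b r * surj a (suc r) + surj b r * surjPos a r) + surj a 0 * surj b 0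
      ≡⟨ cong (_+ surj a 0 * surj b 0) (Σ<-+ (suc M) (λ r → surj b r * surj a (suc r)) (λ r → surj b r * surjPos a r)) ⟩
    (Σ< (suc M) (λ r → surj b r * surj a (suc r)) + (surj b 0 * 0 + Σ< M (λ r → surj b (suc r) * surj a (suc r)))) + surj a 0 * surj b 0
      ≡⟨ cong₂ (λ u v → (u + (v + Σ< M (λ r → surj b (suc r) * surj a (suc r)))) + surj a 0 * surj b 0)
           shifted (*-zeroʳ (surj b 0)) ⟩
    (S + (0 + Σ< M (λ r → surj b (suc r) * surj a (suc r)))) + surj a 0 * surj b 0
      ≡⟨ cong (λ u → (S + u) + surj a 0 * surj b 0) (Σ<-cong M (λ r → *-comm (surj b (suc r)) (surj a (suc r)))) ⟩
    (S + Σ< M (λ r → surj a (suc r) * surj b (suc r))) + surj a 0 * surj b 0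
      ≡⟨ solve 3 (λ x y z → (x :+ y) :+ z := (z :+ y) :+ x) refl S (Σ< M (λ r → surj a (suc r) * surj b (suc r))) (surj a 0 * surj b 0) ⟩
    Σ< (suc M) (λ r → surj a r * surj b r) + S
      ≡⟨ cong (Σ< (suc M) (λ r → surj a r * surj b r) +_) (cong (_+ S) (sym (*-zeroʳ (surj a 0)))) ⟩
    Σ< (suc M) (λ r → surj a r * surj b r) + Σ< (suc M) (λ r → surj a r * surjPrev b r)
      ≡⟨ Σ<-+ (suc M) (λ r → surj a r * surj b r) (λ r → surj a r * surjPrev b r) ⟨
    Σ< (suc M) (λ r → surj a r * surj b r + surj a r * surjPrev b r)
      ≡⟨ Σ<-cong (suc M) (λ r → sym (*-distribˡ-+ (surj a r) (surj b r) (surjPrev b r))) ⟩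
    Σ< (suc M) (λ r → surj a r * (surj b r + surjPrev b r))
      ≡⟨ Σ<-truncate (suc a) (suc M) _ (s≤s (m≤m+n a b)) (λ i le → surj-vanish* a i le (surj b i + surjPrev b i)) ⟩
    altCount a b ∎
    where
    M = a + b
    S = Σ< M (λ r → surj a (suc r) * surj b r)
    shifted : Σ< (suc M) (λ r → surj b r * surj a (suc r)) ≡ S
    shifted = begin
      Σ< (suc M) (λ r → surj b r * surj a (suc r))
        ≡⟨ Σ<-last M _ ⟩
      Σ< M (λ r → surj b r * surj a (suc r)) + surj b M * surj a (suc M)
        ≡⟨ cong (Σ< M (λ r → surj b r * surj a (suc r)) +_)
             (trans (cong (surj b M *_) (surj-vanish a (suc M) (s≤s (m≤m+n a b)))) (*-zeroʳ (surj b M))) ⟩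
      Σ< M (λ r → surj b r * surj a (suc r)) + 0
        ≡⟨ +-identityʳ _ ⟩
      Σ< M (λ r → surj b r * surj a (suc r))
        ≡⟨ Σ<-cong M (λ r → *-comm (surj b r) _) ⟩
      S ∎

  -- Choosing the (nonempty) first run and recursing on the remaining letters.
  altCount-firstRun : ∀ a b →
    Σ< a (λ i → binom a i * altCount b i) ≡ Σ< (suc b) (λ r → surj b r * (surj a (suc r) + surjPos a r))
  altCount-firstRun a b = begin
    Σ< a (λ i → binom a i * Σ< (suc b) (λ r → surj b r * (surj i r + surjPrev i r)))
      ≡⟨ Σ<-cong a (λ i → Σ<-*l (suc b) (binom a i) (λ r → surj b r * (surj i r + surjPrev i r))) ⟩
    Σ< a (λ i → Σ< (suc b) (λ r → binom a i * (surj b r * (surj i r + surjPrev i r))))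
      ≡⟨ Σ<-swap a (suc b) (λ i r → binom a i * (surj b r * (surj i r + surjPrev i r))) ⟩
    Σ< (suc b) (λ r → Σ< a (λ i → binom a i * (surj b r * (surj i r + surjPrev i r))))
      ≡⟨ Σ<-cong (suc b) (λ r → Σ<-cong a (λ i → solve 4 (λ c f x y → c :* (f :* (x :+ y)) := f :* (c :* x :+ c :* y))
                                                  refl (binom a i) (surj b r) (surj i r) (surjPrev i r))) ⟩
    Σ< (suc b) (λ r → Σ< a (λ i → surj b r * (binom a i * surj i r + binom a i * surjPrev i r)))
      ≡⟨ Σ<-cong (suc b) (λ r → sym (Σ<-*l a (surj b r) (λ i → binom a i * surj i r + binom a i * surjPrev i r))) ⟩
    Σ< (suc b) (λ r → surj b r * Σ< a (λ i → binom a i * surj i r + binom a i * surjPrev i r))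
      ≡⟨ Σ<-cong (suc b) (λ r → cong (surj b r *_) (trans (Σ<-+ a (λ i → binom a i * surj i r) (λ i → binom a i * surjPrev i r))
                                                   (cong₂ _+_ (sym (surj-lastFibre a r)) (lastFibre-prev r)))) ⟩
    Σ< (suc b) (λ r → surj b r * (surj a (suc r) + surjPos a r)) ∎
    where
    lastFibre-prev : ∀ r → Σ< a (λ i → binom a i * surjPrev i r) ≡ surjPos a r
    lastFibre-prev zero    = Σ<-vanish a _ (λ i _ → *-zeroʳ (binom a i))
    lastFibre-prev (suc r) = sym (surj-lastFibre a r)

  surjAdj : ℕ → ℕ → ℕ
  surjAdj k r = surj k r + surj k (suc r)

  pairSum : (ℕ → ℕ) → ℕ → ℕ
  pairSum h zero    = h zero
  pairSum h (suc r) = h (suc r) + h r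

  -- Σ_r r! S(n,r) (s(r-1) + 2 s(r) + s(r+1)) with s(j) = j! S(k,j).
  callanCount : ℕ → ℕ → ℕ
  callanCount n k = Σ< (suc n) (λ r → surj n r * pairSum (surjAdj k) r)

  callanCount≡altCount+altCount : ∀ n k → callanCount (suc n) k ≡ altCount (suc n) k + altCount k (suc n)
  callanCount≡altCount+altCount n k = begin
    Σ< (suc n') (λ r → surj n' r * pairSum (surjAdj k) r)
      ≡⟨ Σ<-cong (suc n') (λ r → trans (cong (surj n' r *_) (pairSum-split r))
                                   (*-distribˡ-+ (surj n' r) (surj k r + surjPrev k r) (surj k (suc r) + surjPos k r))) ⟩
    Σ< (suc n') (λ r → surj n' r * (surj k r + surjPrev k r) + surj n' r * (surj k (suc r) + surjPos k r))
      ≡⟨ Σ<-+ (suc n') (λ r → surj n' r * (surj k r + surjPrev k r)) (λ r → surj n' r * (surj k (suc r) + surjPos k r)) ⟩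
    altCount n' k + Σ< (suc n') (λ r → surj n' r * (surj k (suc r) + surjPos k r))
      ≡⟨ cong (altCount n' k +_) (sym (+-identityʳ _)) ⟩
    altCount n' k + (Σ< (suc n') (λ r → surj n' r * (surj k (suc r) + surjPos k r)) + 0)
      ≡⟨ cong (λ z → altCount n' k + (Σ< (suc n') (λ r → surj n' r * (surj k (suc r) + surjPos k r)) + z))
           (sym (trans (cong (surj k 0 *_) (surj-suc-0 n)) (*-zeroʳ (surj k 0)))) ⟩
    altCount n' k + (Σ< (suc n') (λ r → surj n' r * (surj k (suc r) + surjPos k r)) + surj k 0 * surj n' 0)
      ≡⟨ cong (altCount n' k +_) (altCount-byLargeRuns k n') ⟩
    altCount n' k + altCount k n' ∎
    where
    n' = suc n
    pairSum-split : ∀ r → pairSum (surjAdj k) r ≡ (surj k r + surjPrev k r) + (surj k (suc r) + surjPos k r)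
    pairSum-split zero    = solve 2 (λ a b → a :+ b := (a :+ con 0) :+ (b :+ con 0)) refl (surj k 0) (surj k 1)
    pairSum-split (suc r) = solve 3 (λ a b c → (a :+ b) :+ (c :+ a) := (a :+ c) :+ (b :+ a)) refl
                              (surj k (suc r)) (surj k (suc (suc r))) (surj k r)

module DescentsAndAscents where

  open import Data.Nat as ℕ using (ℕ; zero; suc; _+_; _*_; _<_; z≤n; s≤s; _<ᵇ_)
  open import Data.Nat.Properties using (<⇒<ᵇ; <ᵇ⇒<; <-asym)
  open import Data.Bool using (Bool; true; false; if_then_else_; T)
  open import Data.Bool.Properties using (T-≡)
  open import Data.Empty using (⊥-elim)
  open import Data.Product using (_×_; _,_)
  open import Data.List using (List; []; _∷_; map; concatMap; length; applyUpTo; upTo)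
  open import Data.List.Properties using (length-map; length-upTo)
  open import Data.List.Relation.Unary.All as All using (All; []; _∷_)
  import Data.List.Relation.Unary.All.Properties as AllP
  open import Data.Nat.Solver using (module +-*-Solver)
  open +-*-Solver
  open import Function using (_∘_; id; Equivalence)
  open import Relation.Binary.PropositionalEquality
  open ≡-Reasoning
  open ℕSums
  open Surjections

  ascents : List ℕ → ℕ
  ascents (x ∷ y ∷ ys) = (if y <ᵇ x then 0 else 1) + ascents (y ∷ ys)
  ascents _            = 0

  <ᵇ-true : ∀ {x y} → x < y → (x <ᵇ y) ≡ true
  <ᵇ-true x<y = Equivalence.to T-≡ (<⇒<ᵇ x<y)

  <ᵇ-false : ∀ {x y} → x < y → (y <ᵇ x) ≡ false
  <ᵇ-false {x} {y} x<y with y <ᵇ x in eq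
  ... | false = refl
  ... | true  = ⊥-elim (<-asym x<y (<ᵇ⇒< y x (subst T (sym eq) _)))

  if-cong : ∀ {A : Set} {b c : Bool} (u v : A) → b ≡ c → (if b then u else v) ≡ (if c then u else v)
  if-cong u v = cong (λ t → if t then u else v)

  insertion-step : ∀ (b : Bool) (ψ : ℕ → ℕ → ℕ) D A →
    let cD = if b then 1 else 0 ; cA = if b then 0 else 1 in
    ψ (suc D) (suc A) + (D * ψ (cD + D) (cA + suc A) + suc A * ψ (cD + suc D) (cA + A))
    ≡ (cD + D) * ψ (cD + D) (suc (cA + A)) + suc (cA + A) * ψ (suc (cD + D)) (cA + A)
  insertion-step true  ψ D A = solve 4 (λ D A X Y → X :+ (D :* X :+ (con 1 :+ A) :* Y) := (con 1 :+ D) :* X :+ (con 1 :+ A) :* Y)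
                                 refl D A (ψ (suc D) (suc A)) (ψ (suc (suc D)) A)
  insertion-step false ψ D A = solve 4 (λ D A X Z → X :+ (D :* Z :+ (con 1 :+ A) :* X) := D :* Z :+ (con 2 :+ A) :* X)
                                 refl D A (ψ (suc D) (suc A)) (ψ D (suc (suc A)))

  -- Inserting a new minimum into a descent slot keeps the descents and adds an ascent;
  -- inserting it into an ascent slot or at the end adds a descent.
  Σinsertions-after : ∀ x y ys (ψ : ℕ → ℕ → ℕ) → All (x <_) (y ∷ ys) →
    Σ∈ (insertions x ys) (λ u → ψ (descents (y ∷ u)) (ascents (y ∷ u)))
    ≡ descents (y ∷ ys) * ψ (descents (y ∷ ys)) (suc (ascents (y ∷ ys)))
      + suc (ascents (y ∷ ys)) * ψ (suc (descents (y ∷ ys))) (ascents (y ∷ ys))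
  Σinsertions-after x y [] ψ (x<y ∷ []) =
    cong₂ (λ u v → ψ (u + 0) (v + 0) + 0) (if-cong 1 0 (<ᵇ-true x<y)) (if-cong 0 1 (<ᵇ-true x<y))
  Σinsertions-after x y (z ∷ zs) ψ (x<y ∷ x<z ∷ x<zs) = begin
    ψ (descents (y ∷ x ∷ z ∷ zs)) (ascents (y ∷ x ∷ z ∷ zs))
      + Σ∈ (map (z ∷_) (insertions x zs)) (λ u → ψ (descents (y ∷ u)) (ascents (y ∷ u)))
      ≡⟨ cong₂ _+_ (cong₂ ψ descents≡ ascents≡) (Σ∈-map (z ∷_) (insertions x zs) (λ u → ψ (descents (y ∷ u)) (ascents (y ∷ u)))) ⟩
    ψ (suc D) (suc A) + Σ∈ (insertions x zs) (λ u → ψ′ (descents (z ∷ u)) (ascents (z ∷ u)))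
      ≡⟨ cong (ψ (suc D) (suc A) +_) (Σinsertions-after x z zs ψ′ (x<z ∷ x<zs)) ⟩
    ψ (suc D) (suc A) + (D * ψ (cD + D) (cA + suc A) + suc A * ψ (cD + suc D) (cA + A))
      ≡⟨ insertion-step (z <ᵇ y) ψ D A ⟩
    (cD + D) * ψ (cD + D) (suc (cA + A)) + suc (cA + A) * ψ (suc (cD + D)) (cA + A) ∎
    where
    D = descents (z ∷ zs)
    A = ascents (z ∷ zs)
    cD = if z <ᵇ y then 1 else 0
    cA = if z <ᵇ y then 0 else 1
    ψ′ : ℕ → ℕ → ℕ
    ψ′ d a = ψ (cD + d) (cA + a)
    descents≡ : descents (y ∷ x ∷ z ∷ zs) ≡ suc D
    descents≡ = cong₂ (λ u v → u + (v + D)) (if-cong 1 0 (<ᵇ-true x<y)) (if-cong 1 0 (<ᵇ-false x<z))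
    ascents≡ : ascents (y ∷ x ∷ z ∷ zs) ≡ suc A
    ascents≡ = cong₂ (λ u v → u + (v + A)) (if-cong 0 1 (<ᵇ-true x<y)) (if-cong 0 1 (<ᵇ-false x<z))

  Σinsertions-min : ∀ x y ys (ψ : ℕ → ℕ → ℕ) → All (x <_) (y ∷ ys) →
    Σ∈ (insertions x (y ∷ ys)) (λ v → ψ (descents v) (ascents v))
    ≡ suc (descents (y ∷ ys)) * ψ (descents (y ∷ ys)) (suc (ascents (y ∷ ys)))
      + suc (ascents (y ∷ ys)) * ψ (suc (descents (y ∷ ys))) (ascents (y ∷ ys))
  Σinsertions-min x y ys ψ x<all@(x<y ∷ _) = begin
    ψ (descents (x ∷ y ∷ ys)) (ascents (x ∷ y ∷ ys)) + Σ∈ (map (y ∷_) (insertions x ys)) (λ v → ψ (descents v) (ascents v))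
      ≡⟨ cong₂ _+_ (cong₂ ψ (cong (_+ D) (if-cong 1 0 (<ᵇ-false x<y))) (cong (_+ A) (if-cong 0 1 (<ᵇ-false x<y))))
           (Σ∈-map (y ∷_) (insertions x ys) (λ v → ψ (descents v) (ascents v))) ⟩
    ψ D (suc A) + Σ∈ (insertions x ys) (λ u → ψ (descents (y ∷ u)) (ascents (y ∷ u)))
      ≡⟨ cong (ψ D (suc A) +_) (Σinsertions-after x y ys ψ x<all) ⟩
    ψ D (suc A) + (D * ψ D (suc A) + suc A * ψ (suc D) A)
      ≡⟨ solve 4 (λ D A X Y → X :+ (D :* X :+ (con 1 :+ A) :* Y) := (con 1 :+ D) :* X :+ (con 1 :+ A) :* Y)
           refl D A (ψ D (suc A)) (ψ (suc D) A) ⟩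
    suc D * ψ D (suc A) + suc A * ψ (suc D) A ∎
    where
    D = descents (y ∷ ys)
    A = ascents (y ∷ ys)

  Shaped : (ℕ → Set) → ℕ → List ℕ → Set
  Shaped P n w = length w ≡ n × All P w

  insertions-shaped : ∀ {P : ℕ → Set} x w → P x → All P w → All (Shaped P (suc (length w))) (insertions x w)
  insertions-shaped x []       px []         = (refl , px ∷ []) ∷ []
  insertions-shaped {P} x (y ∷ ys) px (py ∷ pys) =
    (refl , px ∷ py ∷ pys) ∷ AllP.map⁺ (All.map prepend (insertions-shaped x ys px pys))
    where
    prepend : ∀ {v} → Shaped P (suc (length ys)) v → Shaped P (suc (length (y ∷ ys))) (y ∷ v)
    prepend (l , a) = cong suc l , py ∷ a

  perms-shaped : ∀ {P : ℕ → Set} xs → All P xs → All (Shaped P (length xs)) (perms xs)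
  perms-shaped []       []         = (refl , []) ∷ []
  perms-shaped {P} (x ∷ xs) (px ∷ pxs) = AllP.concat⁺ (AllP.map⁺ (All.map insert (perms-shaped xs pxs)))
    where
    insert : ∀ {w} → Shaped P (length xs) w → All (Shaped P (length (x ∷ xs))) (insertions x w)
    insert {w} (l , a) = subst (λ n → All (Shaped P (suc n)) (insertions x w)) l (insertions-shaped x w px a)

  applyUpTo-∘ : ∀ (f g : ℕ → ℕ) n → applyUpTo (f ∘ g) n ≡ map f (applyUpTo g n)
  applyUpTo-∘ f g zero    = refl
  applyUpTo-∘ f g (suc n) = cong (f (g 0) ∷_) (applyUpTo-∘ f (g ∘ suc) n)

  range1-suc : ∀ k → range1 (suc k) ≡ 1 ∷ map suc (range1 k)
  range1-suc k = cong (λ l → 1 ∷ map suc l) (applyUpTo-∘ suc id k)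

  length-range1 : ∀ k → length (range1 k) ≡ k
  length-range1 k = trans (length-map suc (upTo k)) (length-upTo k)

  All-positive-map-suc : ∀ xs → All (0 <_) (map suc xs)
  All-positive-map-suc []       = []
  All-positive-map-suc (x ∷ xs) = s≤s z≤n ∷ All-positive-map-suc xs

  perms-range1-shaped : ∀ K → All (Shaped (0 <_) K) (perms (range1 K))
  perms-range1-shaped K = subst (λ t → All (Shaped (0 <_) t) (perms (range1 K))) (length-range1 K)
                            (perms-shaped (range1 K) (All-positive-map-suc (upTo K)))

  Σ∈-insertions-map : ∀ (f : ℕ → ℕ) x ys (g : List ℕ → ℕ) →
    Σ∈ (insertions (f x) (map f ys)) g ≡ Σ∈ (insertions x ys) (g ∘ map f)
  Σ∈-insertions-map f x []       g = refl
  Σ∈-insertions-map f x (y ∷ ys) g = cong (g (f x ∷ f y ∷ map f ys) +_) (begin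
    Σ∈ (map (f y ∷_) (insertions (f x) (map f ys))) g ≡⟨ Σ∈-map (f y ∷_) (insertions (f x) (map f ys)) g ⟩
    Σ∈ (insertions (f x) (map f ys)) (g ∘ (f y ∷_))   ≡⟨ Σ∈-insertions-map f x ys (g ∘ (f y ∷_)) ⟩
    Σ∈ (insertions x ys) (g ∘ map f ∘ (y ∷_))         ≡⟨ sym (Σ∈-map (y ∷_) (insertions x ys) (g ∘ map f)) ⟩
    Σ∈ (map (y ∷_) (insertions x ys)) (g ∘ map f)     ∎)

  Σ∈-perms-map : ∀ (f : ℕ → ℕ) xs (g : List ℕ → ℕ) → Σ∈ (perms (map f xs)) g ≡ Σ∈ (perms xs) (g ∘ map f)
  Σ∈-perms-map f []       g = refl
  Σ∈-perms-map f (x ∷ xs) g = begin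
    Σ∈ (concatMap (insertions (f x)) (perms (map f xs))) g   ≡⟨ Σ∈-concatMap (insertions (f x)) (perms (map f xs)) g ⟩
    Σ∈ (perms (map f xs)) (λ w → Σ∈ (insertions (f x) w) g)  ≡⟨ Σ∈-perms-map f xs (λ w → Σ∈ (insertions (f x) w) g) ⟩
    Σ∈ (perms xs) (λ w → Σ∈ (insertions (f x) (map f w)) g) ≡⟨ Σ∈-cong (perms xs) (λ w → Σ∈-insertions-map f x w g) ⟩
    Σ∈ (perms xs) (λ w → Σ∈ (insertions x w) (g ∘ map f))    ≡⟨ sym (Σ∈-concatMap (insertions x) (perms xs) (g ∘ map f)) ⟩
    Σ∈ (concatMap (insertions x) (perms xs)) (g ∘ map f)     ∎

  descents-map-suc : ∀ w → descents (map suc w) ≡ descents w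
  descents-map-suc []          = refl
  descents-map-suc (x ∷ [])    = refl
  descents-map-suc (x ∷ y ∷ w) = cong ((if y <ᵇ x then 1 else 0) +_) (descents-map-suc (y ∷ w))

  ascents-map-suc : ∀ w → ascents (map suc w) ≡ ascents w
  ascents-map-suc []          = refl
  ascents-map-suc (x ∷ [])    = refl
  ascents-map-suc (x ∷ y ∷ w) = cong ((if y <ᵇ x then 0 else 1) +_) (ascents-map-suc (y ∷ w))

  ΣPerms : ℕ → (ℕ → ℕ → ℕ) → ℕ
  ΣPerms k φ = Σ∈ (perms (range1 k)) (λ w → φ (descents w) (ascents w))

  -- A permutation of [k+2] is one of [k+1], shifted up, with 1 inserted.
  ΣPerms-suc : ∀ k φ → ΣPerms (suc (suc k)) φ ≡ ΣPerms (suc k) (λ d a → suc d * φ d (suc a) + suc a * φ (suc d) a)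
  ΣPerms-suc k φ = begin
    Σ∈ (perms (range1 (suc K))) f
      ≡⟨ cong (λ l → Σ∈ (perms l) f) (range1-suc K) ⟩
    Σ∈ (concatMap (insertions 1) (perms (map suc (range1 K)))) f
      ≡⟨ Σ∈-concatMap (insertions 1) (perms (map suc (range1 K))) f ⟩
    Σ∈ (perms (map suc (range1 K))) (λ w → Σ∈ (insertions 1 w) f)
      ≡⟨ Σ∈-perms-map suc (range1 K) (λ w → Σ∈ (insertions 1 w) f) ⟩
    Σ∈ (perms (range1 K)) (λ w → Σ∈ (insertions 1 (map suc w)) f)
      ≡⟨ Σ∈-congAll (All.map insert1 (perms-range1-shaped K)) ⟩
    ΣPerms K (λ d a → suc d * φ d (suc a) + suc a * φ (suc d) a) ∎
    where
    K = suc k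
    f : List ℕ → ℕ
    f v = φ (descents v) (ascents v)
    insert1 : ∀ {w} → Shaped (0 <_) K w →
      Σ∈ (insertions 1 (map suc w)) f
      ≡ suc (descents w) * φ (descents w) (suc (ascents w)) + suc (ascents w) * φ (suc (descents w)) (ascents w)
    insert1 {[]}     (() , _)
    insert1 {y ∷ ys} (_ , pos) =
      trans (Σinsertions-min 1 (suc y) (map suc ys) φ (AllP.map⁺ (All.map s≤s pos)))
            (cong₂ (λ d a → suc d * φ d (suc a) + suc a * φ (suc d) a) (descents-map-suc (y ∷ ys)) (ascents-map-suc (y ∷ ys)))

module Worpitzky where

  open import Data.Nat as ℕ using (ℕ; zero; suc; _+_; _*_; z≤n; s≤s)
  open import Data.Nat.Properties
  open import Data.Nat.Solver using (module +-*-Solver)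
  open +-*-Solver
  open import Relation.Binary.PropositionalEquality
  open ≡-Reasoning
  open ℕSums
  open Surjections
  open DescentsAndAscents

  -- binomShift c t d = binom c (t - d), and 0 when t < d.
  binomShift : ℕ → ℕ → ℕ → ℕ
  binomShift c t       zero    = binom c t
  binomShift c zero    (suc d) = 0
  binomShift c (suc t) (suc d) = binomShift c t d

  binomShift-pascal : ∀ a t d → binomShift (suc a) t d ≡ binomShift a t d + binomShift a t (suc d)
  binomShift-pascal a zero    zero    = refl
  binomShift-pascal a (suc t) zero    = +-comm (binom a t) (binom a (suc t))
  binomShift-pascal a zero    (suc d) = refl
  binomShift-pascal a (suc t) (suc d) = binomShift-pascal a t d

  binomShift-step : ∀ a t d →
    suc d * binomShift (suc a) t d + suc a * binomShift a t (suc d) ≡ suc t * (binomShift a t d + binomShift a t (suc d))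
  binomShift-step a zero    zero    = solve 1 (λ a → con 1 :* con 1 :+ (con 1 :+ a) :* con 0 := con 1 :* (con 1 :+ con 0)) refl a
  binomShift-step a (suc t) zero    = begin
    1 * (binom a t + binom a (suc t)) + suc a * binom a t
      ≡⟨ solve 4 (λ a t B0 B1 → con 1 :* (B0 :+ B1) :+ (con 1 :+ a) :* B0 := con 2 :* B0 :+ B1 :+ a :* B0) refl a t (binom a t) (binom a (suc t)) ⟩
    2 * binom a t + binom a (suc t) + a * binom a t
      ≡⟨ cong (2 * binom a t + binom a (suc t) +_) (sym (binom-absorb a t)) ⟩
    2 * binom a t + binom a (suc t) + (suc t * binom a (suc t) + t * binom a t)
      ≡⟨ solve 4 (λ a t B0 B1 → con 2 :* B0 :+ B1 :+ ((con 1 :+ t) :* B1 :+ t :* B0) := (con 2 :+ t) :* (B1 :+ B0)) refl a t (binom a t) (binom a (suc t)) ⟩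
    suc (suc t) * (binom a (suc t) + binom a t) ∎
  binomShift-step a zero    (suc d) = solve 2 (λ a d → (con 2 :+ d) :* con 0 :+ (con 1 :+ a) :* con 0 := con 1 :* (con 0 :+ con 0)) refl a d
  binomShift-step a (suc t) (suc d) = begin
    suc (suc d) * binomShift (suc a) t d + suc a * binomShift a t (suc d)
      ≡⟨ solve 4 (λ d a X Y → (con 2 :+ d) :* X :+ (con 1 :+ a) :* Y := ((con 1 :+ d) :* X :+ (con 1 :+ a) :* Y) :+ X)
           refl d a (binomShift (suc a) t d) (binomShift a t (suc d)) ⟩
    (suc d * binomShift (suc a) t d + suc a * binomShift a t (suc d)) + binomShift (suc a) t d
      ≡⟨ cong₂ _+_ (binomShift-step a t d) (binomShift-pascal a t d) ⟩
    suc t * (binomShift a t d + binomShift a t (suc d)) + (binomShift a t d + binomShift a t (suc d))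
      ≡⟨ solve 2 (λ t X → t :* X :+ X := (con 1 :+ t) :* X) refl (suc t) (binomShift a t d + binomShift a t (suc d)) ⟩
    suc (suc t) * (binomShift a t d + binomShift a t (suc d)) ∎

  -- Both sides obey the recurrence of surj (k+1) s; on the left this is ΣPerms-suc.
  worpitzky : ∀ k s → ΣPerms (suc k) (λ d a → binomShift a s (suc d)) ≡ surj (suc k) s
  worpitzky zero    zero          = sym (surj-suc-0 0)
  worpitzky zero    (suc zero)    = sym (trans (surj-suc-suc 0 0) (cong₂ (λ u v → 1 * (u + v)) (surj-0-suc 0) surj-0-0))
  worpitzky zero    (suc (suc s)) = sym (surj-vanish 1 (suc (suc s)) (s≤s (s≤s z≤n)))
  worpitzky (suc k) zero          = begin
    ΣPerms (suc (suc k)) (λ d a → binomShift a 0 (suc d))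
      ≡⟨ ΣPerms-suc k (λ d a → binomShift a 0 (suc d)) ⟩
    ΣPerms (suc k) (λ d a → suc d * binomShift (suc a) 0 (suc d) + suc a * binomShift a 0 (suc (suc d)))
      ≡⟨ Σ∈-vanish (perms (range1 (suc k))) _ (λ w → cong₂ _+_ (*-zeroʳ (suc (descents w))) (*-zeroʳ (suc (ascents w)))) ⟩
    0 ≡⟨ sym (surj-suc-0 (suc k)) ⟩
    surj (suc (suc k)) 0 ∎
  worpitzky (suc k) (suc s) = begin
    ΣPerms (suc (suc k)) (λ d a → binomShift a (suc s) (suc d))
      ≡⟨ ΣPerms-suc k (λ d a → binomShift a (suc s) (suc d)) ⟩
    ΣPerms (suc k) (λ d a → suc d * binomShift (suc a) s d + suc a * binomShift a s (suc d))
      ≡⟨ Σ∈-cong L (λ w → binomShift-step (ascents w) s (descents w)) ⟩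
    ΣPerms (suc k) (λ d a → suc s * (binomShift a (suc s) (suc d) + binomShift a s (suc d)))
      ≡⟨ sym (Σ∈-*l L (suc s) (λ w → binomShift (ascents w) (suc s) (suc (descents w)) + binomShift (ascents w) s (suc (descents w)))) ⟩
    suc s * Σ∈ L (λ w → binomShift (ascents w) (suc s) (suc (descents w)) + binomShift (ascents w) s (suc (descents w)))
      ≡⟨ cong (suc s *_) (Σ∈-+ L (λ w → binomShift (ascents w) (suc s) (suc (descents w))) (λ w → binomShift (ascents w) s (suc (descents w)))) ⟩
    suc s * (ΣPerms (suc k) (λ d a → binomShift a (suc s) (suc d)) + ΣPerms (suc k) (λ d a → binomShift a s (suc d)))
      ≡⟨ cong (suc s *_) (cong₂ _+_ (worpitzky k (suc s)) (worpitzky k s)) ⟩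
    suc s * (surj (suc k) (suc s) + surj (suc k) s) ≡⟨ sym (surj-suc-suc (suc k) s) ⟩
    surj (suc (suc k)) (suc s) ∎
    where L = perms (range1 (suc k))

module EulerianSum where

  open import Data.Nat as ℕ using (ℕ; zero; suc; _+_; _*_; _∸_; _≤_; _<_; z≤n; s≤s; _<ᵇ_; _≟_)
  open import Data.Nat.Properties hiding (_≟_)
  open import Data.Nat.Combinatorics using (_C_)
  open import Data.Bool using (true; false; if_then_else_)
  open import Data.Product using (_,_)
  open import Data.List using (List; []; _∷_; length; filter)
  open import Data.List.Relation.Unary.All as All using (All; []; _∷_)
  open import Relation.Nullary using (does)
  open import Data.Nat.Solver using (module +-*-Solver)
  open +-*-Solver
  open import Relation.Binary.PropositionalEquality
  open ≡-Reasoning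
  open ℕSums
  open Surjections
  open AlternatingCounts
  open DescentsAndAscents
  open Worpitzky

  δ : ℕ → ℕ → ℕ
  δ r j = if does (r ≟ j) then 1 else 0

  Σ<-δ : ∀ N r (φ : ℕ → ℕ) → r < N → Σ< N (λ j → δ r j * φ j) ≡ φ r
  Σ<-δ (suc N) zero    φ _         =
    trans (cong₂ _+_ (+-identityʳ (φ 0)) (Σ<-vanish N (λ j → δ 0 (suc j) * φ (suc j)) (λ _ _ → refl))) (+-identityʳ (φ 0))
  Σ<-δ (suc N) (suc r) φ (s≤s r<N) = Σ<-δ N r (λ j → φ (suc j)) r<N

  length-filter-runs-∷ : ∀ w L j →
    length (filter (λ π → runs π ≟ j) (w ∷ L)) ≡ δ (runs w) j + length (filter (λ π → runs π ≟ j) L)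
  length-filter-runs-∷ w L j with does (runs w ≟ j)
  ... | true  = refl
  ... | false = refl

  Σ<-countByRuns : ∀ (L : List (List ℕ)) K (φ : ℕ → ℕ) → All (λ w → runs w ≤ K) L →
    Σ< (suc K) (λ j → length (filter (λ π → runs π ≟ j) L) * φ j) ≡ Σ∈ L (λ w → φ (runs w))
  Σ<-countByRuns []      K φ []       = Σ<-vanish (suc K) (λ j → 0 * φ j) (λ _ _ → refl)
  Σ<-countByRuns (w ∷ L) K φ (p ∷ ps) = begin
    Σ< (suc K) (λ j → length (filter (λ π → runs π ≟ j) (w ∷ L)) * φ j)
      ≡⟨ Σ<-cong (suc K) (λ j → trans (cong (_* φ j) (length-filter-runs-∷ w L j)) (*-distribʳ-+ (φ j) (δ (runs w) j) _)) ⟩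
    Σ< (suc K) (λ j → δ (runs w) j * φ j + length (filter (λ π → runs π ≟ j) L) * φ j)
      ≡⟨ Σ<-+ (suc K) (λ j → δ (runs w) j * φ j) (λ j → length (filter (λ π → runs π ≟ j) L) * φ j) ⟩
    Σ< (suc K) (λ j → δ (runs w) j * φ j) + Σ< (suc K) (λ j → length (filter (λ π → runs π ≟ j) L) * φ j)
      ≡⟨ cong₂ _+_ (Σ<-δ (suc K) (runs w) φ (s≤s p)) (Σ<-countByRuns L K φ ps) ⟩
    φ (runs w) + Σ∈ L (λ w → φ (runs w)) ∎

  descents+ascents : ∀ x xs → descents (x ∷ xs) + ascents (x ∷ xs) ≡ length xs
  descents+ascents x []       = refl
  descents+ascents x (y ∷ ys) with y <ᵇ x
  ... | true  = cong suc (descents+ascents y ys)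
  ... | false = trans (+-suc (descents (y ∷ ys)) (ascents (y ∷ ys))) (cong suc (descents+ascents y ys))

  runs≤length : ∀ {P} k w → Shaped P k w → runs w ≤ k
  runs≤length k []       _       = z≤n
  runs≤length k (x ∷ xs) (l , _) =
    subst (suc (descents (x ∷ xs)) ≤_) l (s≤s (subst (descents (x ∷ xs) ≤_) (descents+ascents x xs) (m≤m+n _ _)))

  innerSum : ℕ → ℕ → ℕ → ℕ
  innerSum n k j = sumTo (k + 2 ∸ j) (λ m → ((k + 2 ∸ j) C m) * facStirShift n (m + j))

  innerSumDA : ℕ → ℕ → ℕ → ℕ
  innerSumDA n d a = Σ< (suc (suc (suc a))) (λ m → binom (suc (suc a)) m * surj n (m + d))

  innerSum≡innerSumDA : ∀ n d a → innerSum n (suc (d + a)) (suc d) ≡ innerSumDA n d a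
  innerSum≡innerSumDA n d a = begin
    sumTo (suc (d + a) + 2 ∸ suc d) (λ m → ((suc (d + a) + 2 ∸ suc d) C m) * facStirShift n (m + suc d))
      ≡⟨ cong (λ t → sumTo t (λ m → (t C m) * facStirShift n (m + suc d))) a+2 ⟩
    sumTo (suc (suc a)) (λ m → ((suc (suc a)) C m) * facStirShift n (m + suc d))
      ≡⟨ sumTo≡Σ< (suc (suc a)) (λ m → ((suc (suc a)) C m) * facStirShift n (m + suc d)) ⟩
    Σ< (suc (suc (suc a))) (λ m → ((suc (suc a)) C m) * facStirShift n (m + suc d))
      ≡⟨ Σ<-cong (suc (suc (suc a))) (λ m → cong₂ _*_ (C≡binom (suc (suc a)) m)
                                            (trans (cong (facStirShift n) (+-suc m d)) (sym (surj≡ n (m + d))))) ⟩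
    innerSumDA n d a ∎
    where
    a+2 : suc (d + a) + 2 ∸ suc d ≡ suc (suc a)
    a+2 = trans (cong (_∸ d) (+-assoc d a 2)) (trans (m+n∸m≡n d (a + 2)) (+-comm a 2))

  innerSum-runs : ∀ {P} n k w → Shaped P (suc k) w → innerSum n (suc k) (runs w) ≡ innerSumDA n (descents w) (ascents w)
  innerSum-runs n k []       (() , _)
  innerSum-runs n k (x ∷ xs) (l , _) =
    trans (cong (λ t → innerSum n t (suc (descents (x ∷ xs)))) (trans (sym l) (cong suc (sym (descents+ascents x xs)))))
          (innerSum≡innerSumDA n (descents (x ∷ xs)) (ascents (x ∷ xs)))

  middleSum≡ΣPerms : ∀ n k → middleSum n (suc k) ≡ ΣPerms (suc k) (innerSumDA n)
  middleSum≡ΣPerms n k = begin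
    middleSum n K
      ≡⟨ sumTo≡Σ< K (λ j → eulerian K j * innerSum n K j) ⟩
    Σ< (suc K) (λ j → eulerian K j * innerSum n K j)
      ≡⟨ Σ<-countByRuns (perms (range1 K)) K (innerSum n K) (All.map (λ {w} → runs≤length K w) (perms-range1-shaped K)) ⟩
    Σ∈ (perms (range1 K)) (λ w → innerSum n K (runs w))
      ≡⟨ Σ∈-congAll (All.map (λ {w} → innerSum-runs n k w) (perms-range1-shaped K)) ⟩
    ΣPerms K (innerSumDA n) ∎
    where K = suc k

  pairSum-surjAdj≡ΣPerms : ∀ k r → pairSum (surjAdj (suc k)) r ≡ ΣPerms (suc k) (λ d a → binomShift (suc (suc a)) r d)
  pairSum-surjAdj≡ΣPerms k zero = begin
    surj K 0 + surj K 1
      ≡⟨ sym (cong₂ _+_ (worpitzky k 0) (worpitzky k 1)) ⟩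
    ΣPerms K (λ d a → binomShift a 0 (suc d)) + ΣPerms K (λ d a → binomShift a 1 (suc d))
      ≡⟨ sym (Σ∈-+ L (λ w → binomShift (ascents w) 0 (suc (descents w))) (λ w → binomShift (ascents w) 1 (suc (descents w)))) ⟩
    ΣPerms K (λ d a → binomShift a 0 (suc d) + binomShift a 1 (suc d))
      ≡⟨ Σ∈-cong L (λ w → pascal₀ (descents w) (ascents w)) ⟩
    ΣPerms K (λ d a → binomShift (suc (suc a)) 0 d) ∎
    where
    K = suc k
    L = perms (range1 K)
    pascal₀ : ∀ d a → binomShift a 0 (suc d) + binomShift a 1 (suc d) ≡ binomShift (suc (suc a)) 0 d
    pascal₀ zero    a = refl
    pascal₀ (suc d) a = refl
  pairSum-surjAdj≡ΣPerms k (suc t) = begin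
    (surj K (suc t) + surj K (suc (suc t))) + (surj K t + surj K (suc t))
      ≡⟨ sym (cong₂ _+_ (cong₂ _+_ (worpitzky k (suc t)) (worpitzky k (suc (suc t))))
                        (cong₂ _+_ (worpitzky k t) (worpitzky k (suc t)))) ⟩
    (ΣPerms K g₁ + ΣPerms K g₂) + (ΣPerms K g₀ + ΣPerms K g₁)
      ≡⟨ sym (cong₂ _+_ (Σ∈-+ L (λ w → g₁ (descents w) (ascents w)) (λ w → g₂ (descents w) (ascents w)))
                        (Σ∈-+ L (λ w → g₀ (descents w) (ascents w)) (λ w → g₁ (descents w) (ascents w)))) ⟩
    ΣPerms K (λ d a → g₁ d a + g₂ d a) + ΣPerms K (λ d a → g₀ d a + g₁ d a)
      ≡⟨ sym (Σ∈-+ L (λ w → g₁ (descents w) (ascents w) + g₂ (descents w) (ascents w))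
                     (λ w → g₀ (descents w) (ascents w) + g₁ (descents w) (ascents w))) ⟩
    ΣPerms K (λ d a → (g₁ d a + g₂ d a) + (g₀ d a + g₁ d a))
      ≡⟨ Σ∈-cong L (λ w → pascal₂ (descents w) (ascents w)) ⟩
    ΣPerms K (λ d a → binomShift (suc (suc a)) (suc t) d) ∎
    where
    K = suc k
    L = perms (range1 K)
    g₀ g₁ g₂ : ℕ → ℕ → ℕ
    g₀ d a = binomShift a t (suc d)
    g₁ d a = binomShift a (suc t) (suc d)
    g₂ d a = binomShift a (suc (suc t)) (suc d)
    pascal₂ : ∀ d a → (g₁ d a + g₂ d a) + (g₀ d a + g₁ d a) ≡ binomShift (suc (suc a)) (suc t) d
    pascal₂ d a = sym (begin
      binomShift (suc (suc a)) (suc t) d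
        ≡⟨ binomShift-pascal (suc a) (suc t) d ⟩
      binomShift (suc a) (suc t) d + binomShift (suc a) (suc t) (suc d)
        ≡⟨ cong₂ _+_ (binomShift-pascal a (suc t) d) (binomShift-pascal a (suc t) (suc d)) ⟩
      (g₂ d a + g₁ d a) + (g₁ d a + g₀ d a)
        ≡⟨ solve 3 (λ x y z → (z :+ y) :+ (y :+ x) := (y :+ z) :+ (x :+ y)) refl (g₀ d a) (g₁ d a) (g₂ d a) ⟩
      (g₁ d a + g₂ d a) + (g₀ d a + g₁ d a) ∎)

  Σ<-binomShift : ∀ d N (f : ℕ → ℕ) c → Σ< (d + N) (λ r → f r * binomShift c r d) ≡ Σ< N (λ m → f (m + d) * binom c m)
  Σ<-binomShift zero    N f c = Σ<-cong N (λ m → cong (λ t → f t * binom c m) (sym (+-identityʳ m)))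
  Σ<-binomShift (suc d) N f c = begin
    f 0 * 0 + Σ< (d + N) (λ r → f (suc r) * binomShift c r d)
      ≡⟨ cong (_+ Σ< (d + N) (λ r → f (suc r) * binomShift c r d)) (*-zeroʳ (f 0)) ⟩
    Σ< (d + N) (λ r → f (suc r) * binomShift c r d)
      ≡⟨ Σ<-binomShift d N (λ r → f (suc r)) c ⟩
    Σ< N (λ m → f (suc (m + d)) * binom c m)
      ≡⟨ Σ<-cong N (λ m → cong (λ t → f t * binom c m) (sym (+-suc m d))) ⟩
    Σ< N (λ m → f (m + suc d) * binom c m) ∎

  Σ<-surj-binomShift : ∀ n d a → Σ< (suc n) (λ r → surj n r * binomShift (suc (suc a)) r d) ≡ innerSumDA n d a
  Σ<-surj-binomShift n d a = begin
    Σ< (suc n) (λ r → surj n r * binomShift c r d)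
      ≡⟨ sym (Σ<-truncate (suc n) (d + N) _ (≤-trans (m≤m+n (suc n) (suc c)) (m≤n+m N d))
               (λ i n<i → cong (_* binomShift c i d) (surj-vanish n i n<i))) ⟩
    Σ< (d + N) (λ r → surj n r * binomShift c r d)
      ≡⟨ Σ<-binomShift d N (surj n) c ⟩
    Σ< N (λ m → surj n (m + d) * binom c m)
      ≡⟨ Σ<-cong N (λ m → *-comm (surj n (m + d)) (binom c m)) ⟩
    Σ< N (λ m → binom c m * surj n (m + d))
      ≡⟨ Σ<-truncate (suc c) N _ (m≤n+m (suc c) (suc n)) (λ i c<i → cong (_* surj n (i + d)) (binom-vanish c i c<i)) ⟩
    innerSumDA n d a ∎
    where
    c = suc (suc a)
    N = suc n + suc c

  middleSum≡callanCount : ∀ n k → middleSum n (suc k) ≡ callanCount n (suc k)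
  middleSum≡callanCount n k = begin
    middleSum n K
      ≡⟨ middleSum≡ΣPerms n k ⟩
    ΣPerms K (innerSumDA n)
      ≡⟨ sym (Σ∈-cong L (λ w → Σ<-surj-binomShift n (descents w) (ascents w))) ⟩
    Σ∈ L (λ w → Σ< (suc n) (λ r → surj n r * binomShift (suc (suc (ascents w))) r (descents w)))
      ≡⟨ Σ∈-Σ< L (suc n) (λ w r → surj n r * binomShift (suc (suc (ascents w))) r (descents w)) ⟩
    Σ< (suc n) (λ r → Σ∈ L (λ w → surj n r * binomShift (suc (suc (ascents w))) r (descents w)))
      ≡⟨ Σ<-cong (suc n) (λ r → sym (Σ∈-*l L (surj n r) (λ w → binomShift (suc (suc (ascents w))) r (descents w)))) ⟩
    Σ< (suc n) (λ r → surj n r * ΣPerms K (λ d a → binomShift (suc (suc a)) r d))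
      ≡⟨ Σ<-cong (suc n) (λ r → cong (surj n r *_) (sym (pairSum-surjAdj≡ΣPerms k r))) ⟩
    callanCount n K ∎
    where
    K = suc k
    L = perms (range1 K)

module PolyBernoulliNumbers where

  open import Data.Nat as ℕ using (ℕ; zero; suc; _<_; s≤s; _^_)
  import Data.Nat.Properties as NP
  open import Data.Integer as ℤ using (ℤ; +_; -_; _+_; _*_; _-_)
  import Data.Integer.Properties as ZP
  open import Data.Nat.Combinatorics using (_C_)
  open import Function using (_∘_; id)
  open import Relation.Binary.PropositionalEquality
  open ≡-Reasoning
  open import Data.Integer.Solver using (module +-*-Solver)
  open +-*-Solver using (solve; _:+_; _:*_; _:-_; _:=_; con)
  import Data.Nat.Solver as ℕSolver
  module NS = ℕSolver.+-*-Solver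
  open Summation
  open ℕSums
  open Surjections
  open AlternatingCounts using (surjAdj; pairSum; callanCount)

  module ℤSums = Sums (+ 0) _+_ ZP.+-identityˡ ZP.+-assoc ZP.+-comm
  open ℤSums using () renaming ( Σ< to Σℤ; Σ<-cong to Σℤ-cong; Σ<-cong< to Σℤ-cong<; Σ<-+ to Σℤ-+; Σ<-last to Σℤ-last
                               ; Σ<-vanish to Σℤ-vanish; foldr-applyUpTo to foldr-applyUpToℤ)
  open ℤSums.Distributive _*_ ZP.*-distribˡ-+ ZP.*-zeroʳ using () renaming (Σ<-*l to Σℤ-*l)

  Σℤ-neg : ∀ n f → Σℤ n (λ i → - f i) ≡ - Σℤ n f
  Σℤ-neg zero f = refl
  Σℤ-neg (suc n) f = trans (cong (λ z → (- f 0) + z) (Σℤ-neg n (f ∘ suc))) (sym (ZP.neg-distrib-+ (f 0) _))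

  Σℤ-sub : ∀ n f g → Σℤ n (λ i → f i - g i) ≡ Σℤ n f - Σℤ n g
  Σℤ-sub n f g = trans (Σℤ-+ n f (λ i → - g i)) (cong (λ z → Σℤ n f + z) (Σℤ-neg n g))

  +Σ<≡Σℤ : ∀ n f → + (Σ< n f) ≡ Σℤ n (λ i → + f i)
  +Σ<≡Σℤ zero f = refl
  +Σ<≡Σℤ (suc n) f = cong (λ z → + f 0 + z) (+Σ<≡Σℤ n (f ∘ suc))

  sumToℤ≡Σℤ : ∀ n f → sumToℤ n f ≡ Σℤ (suc n) f
  sumToℤ≡Σℤ n f = foldr-applyUpToℤ f id (suc n)

  egfMul≡Σℤ : ∀ f g n → egfMul f g n ≡ Σℤ (suc n) (λ j → + binom n j * (f j * g (n ℕ.∸ j)))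
  egfMul≡Σℤ f g n = trans (sumToℤ≡Σℤ n (λ j → + (n C j) * (f j * g (n ℕ.∸ j))))
                          (Σℤ-cong (suc n) (λ j → cong (λ c → + c * (f j * g (n ℕ.∸ j))) (C≡binom n j)))

  egfMul-cong : ∀ {f f' g g'} n → (∀ m → f m ≡ f' m) → (∀ m → g m ≡ g' m) → egfMul f g n ≡ egfMul f' g' n
  egfMul-cong {f} {f'} {g} {g'} n ef eg =
    trans (egfMul≡Σℤ f g n)
          (trans (Σℤ-cong (suc n) (λ j → cong₂ (λ a b → + binom n j * (a * b)) (ef j) (eg (n ℕ.∸ j))))
                 (sym (egfMul≡Σℤ f' g' n)))

  egfMul-subˡ : ∀ f h g n → egfMul (λ m → f m - h m) g n ≡ egfMul f g n - egfMul h g n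
  egfMul-subˡ f h g n = begin
    egfMul (λ m → f m - h m) g n ≡⟨ egfMul≡Σℤ (λ m → f m - h m) g n ⟩
    Σℤ (suc n) (λ j → + binom n j * ((f j - h j) * g (n ℕ.∸ j)))
      ≡⟨ Σℤ-cong (suc n) (λ j → solve 4 (λ c a b x → c :* ((a :- b) :* x) := c :* (a :* x) :- c :* (b :* x)) refl (+ binom n j) (f j) (h j) (g (n ℕ.∸ j))) ⟩
    Σℤ (suc n) (λ j → + binom n j * (f j * g (n ℕ.∸ j)) - + binom n j * (h j * g (n ℕ.∸ j)))
      ≡⟨ Σℤ-sub (suc n) (λ j → + binom n j * (f j * g (n ℕ.∸ j))) (λ j → + binom n j * (h j * g (n ℕ.∸ j))) ⟩
    Σℤ (suc n) (λ j → + binom n j * (f j * g (n ℕ.∸ j))) - Σℤ (suc n) (λ j → + binom n j * (h j * g (n ℕ.∸ j))) ≡⟨ sym (cong₂ _-_ (egfMul≡Σℤ f g n) (egfMul≡Σℤ h g n)) ⟩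
    egfMul f g n - egfMul h g n ∎

  egfMul-subʳ : ∀ f g h n → egfMul f (λ m → g m - h m) n ≡ egfMul f g n - egfMul f h n
  egfMul-subʳ f g h n = begin
    egfMul f (λ m → g m - h m) n ≡⟨ egfMul≡Σℤ f (λ m → g m - h m) n ⟩
    Σℤ (suc n) (λ j → + binom n j * (f j * (g (n ℕ.∸ j) - h (n ℕ.∸ j))))
      ≡⟨ Σℤ-cong (suc n) (λ j → solve 4 (λ c a b x → c :* (x :* (a :- b)) := c :* (x :* a) :- c :* (x :* b)) refl (+ binom n j) (g (n ℕ.∸ j)) (h (n ℕ.∸ j)) (f j)) ⟩
    Σℤ (suc n) (λ j → + binom n j * (f j * g (n ℕ.∸ j)) - + binom n j * (f j * h (n ℕ.∸ j)))
      ≡⟨ Σℤ-sub (suc n) (λ j → + binom n j * (f j * g (n ℕ.∸ j))) (λ j → + binom n j * (f j * h (n ℕ.∸ j))) ⟩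
    Σℤ (suc n) (λ j → + binom n j * (f j * g (n ℕ.∸ j))) - Σℤ (suc n) (λ j → + binom n j * (f j * h (n ℕ.∸ j))) ≡⟨ sym (cong₂ _-_ (egfMul≡Σℤ f g n) (egfMul≡Σℤ f h n)) ⟩
    egfMul f g n - egfMul f h n ∎

  egfMul-scaleʳ : ∀ f g c n → egfMul f (λ m → c * g m) n ≡ c * egfMul f g n
  egfMul-scaleʳ f g c n = begin
    egfMul f (λ m → c * g m) n ≡⟨ egfMul≡Σℤ f (λ m → c * g m) n ⟩
    Σℤ (suc n) (λ j → + binom n j * (f j * (c * g (n ℕ.∸ j))))
      ≡⟨ Σℤ-cong (suc n) (λ j → solve 4 (λ b x c y → b :* (x :* (c :* y)) := c :* (b :* (x :* y))) refl (+ binom n j) (f j) c (g (n ℕ.∸ j))) ⟩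
    Σℤ (suc n) (λ j → c * (+ binom n j * (f j * g (n ℕ.∸ j))))
      ≡⟨ sym (Σℤ-*l (suc n) c (λ j → + binom n j * (f j * g (n ℕ.∸ j)))) ⟩
    c * Σℤ (suc n) (λ j → + binom n j * (f j * g (n ℕ.∸ j)))
      ≡⟨ cong (c *_) (sym (egfMul≡Σℤ f g n)) ⟩
    c * egfMul f g n ∎

  egfMul-identityˡ : ∀ g n → egfMul egfOne g n ≡ g n
  egfMul-identityˡ g n = begin
    egfMul egfOne g n ≡⟨ egfMul≡Σℤ egfOne g n ⟩
    + 1 * (+ 1 * g n) + Σℤ n (λ j → + binom n (suc j) * (+ 0 * g (n ℕ.∸ suc j)))
      ≡⟨ cong₂ _+_ (trans (ZP.*-identityˡ (+ 1 * g n)) (ZP.*-identityˡ (g n))) (Σℤ-vanish n (λ j → + binom n (suc j) * (+ 0 * g (n ℕ.∸ suc j))) (λ j _ → ZP.*-zeroʳ (+ binom n (suc j)))) ⟩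
    g n + + 0 ≡⟨ ZP.+-identityʳ (g n) ⟩
    g n ∎

  egfMul-suc : ∀ f g n → egfMul f g (suc n) ≡ egfMul (f ∘ suc) g n + egfMul f (g ∘ suc) n
  egfMul-suc f g n = begin
    egfMul f g (suc n) ≡⟨ egfMul≡Σℤ f g (suc n) ⟩
    + 1 * (f 0 * g (suc n)) + Σℤ (suc n) (λ j → + binom (suc n) (suc j) * (f (suc j) * g (n ℕ.∸ j)))
      ≡⟨ cong (λ z → + 1 * (f 0 * g (suc n)) + z) (Σℤ-cong (suc n) (λ j → ZP.*-distribʳ-+ (f (suc j) * g (n ℕ.∸ j)) (+ binom n j) (+ binom n (suc j)))) ⟩
    + 1 * (f 0 * g (suc n)) + Σℤ (suc n) (λ j → + binom n j * (f (suc j) * g (n ℕ.∸ j)) + + binom n (suc j) * (f (suc j) * g (n ℕ.∸ j)))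
      ≡⟨ cong (λ z → + 1 * (f 0 * g (suc n)) + z) (Σℤ-+ (suc n) (λ j → + binom n j * (f (suc j) * g (n ℕ.∸ j))) (λ j → + binom n (suc j) * (f (suc j) * g (n ℕ.∸ j)))) ⟩
    X + (P + Q) ≡⟨ solve 3 (λ x p q → x :+ (p :+ q) := p :+ (x :+ q)) refl X P Q ⟩
    P + (X + Q) ≡⟨ cong₂ _+_ (sym (egfMul≡Σℤ (f ∘ suc) g n)) Qeq ⟩
    egfMul (f ∘ suc) g n + egfMul f (g ∘ suc) n ∎
    where
    X = + 1 * (f 0 * g (suc n))
    P = Σℤ (suc n) (λ j → + binom n j * (f (suc j) * g (n ℕ.∸ j)))
    Q = Σℤ (suc n) (λ j → + binom n (suc j) * (f (suc j) * g (n ℕ.∸ j)))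
    Qeq : X + Q ≡ egfMul f (g ∘ suc) n
    Qeq = begin
      X + Q ≡⟨ cong (λ z → X + z) (Σℤ-last n (λ j → + binom n (suc j) * (f (suc j) * g (n ℕ.∸ j)))) ⟩
      X + (Σℤ n (λ j → + binom n (suc j) * (f (suc j) * g (n ℕ.∸ j))) + + binom n (suc n) * (f (suc n) * g (n ℕ.∸ n)))
        ≡⟨ cong (λ z → X + (Σℤ n (λ j → + binom n (suc j) * (f (suc j) * g (n ℕ.∸ j))) + z)) 
             (cong (λ b → + b * (f (suc n) * g (n ℕ.∸ n))) (binom-vanish n (suc n) (NP.n<1+n n))) ⟩
      X + (Σℤ n (λ j → + binom n (suc j) * (f (suc j) * g (n ℕ.∸ j))) + + 0)
        ≡⟨ cong (λ z → X + z) (ZP.+-identityʳ _) ⟩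
      X + Σℤ n (λ j → + binom n (suc j) * (f (suc j) * g (n ℕ.∸ j)))
        ≡⟨ cong (λ z → X + z) (Σℤ-cong< n (λ j lt → cong (λ t → + binom n (suc j) * (f (suc j) * g t)) (NP.+-∸-assoc 1 lt))) ⟩
      X + Σℤ n (λ j → + binom n (suc j) * (f (suc j) * g (suc (n ℕ.∸ suc j))))
        ≡⟨ sym (egfMul≡Σℤ f (g ∘ suc) n) ⟩
      egfMul f (g ∘ suc) n ∎


  powCoeff : ℕ → ℕ → ℤ
  powCoeff i n = egfPow oneMinusExpNeg i n

  oneMinusExpNeg-suc : ∀ m → oneMinusExpNeg (suc m) ≡ egfOne m - oneMinusExpNeg m
  oneMinusExpNeg-suc zero = refl
  oneMinusExpNeg-suc (suc m) = solve 1 (λ x → con (- + 1) :* x := con (+ 0) :- x) refl (oneMinusExpNeg (suc m))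

  powCoeffPrev : ℕ → ℕ → ℤ
  powCoeffPrev zero m = + 0
  powCoeffPrev (suc i) m = powCoeff i m

  *-egfMul-powCoeffPrev : ∀ i n → + i * egfMul oneMinusExpNeg (powCoeffPrev i) n ≡ + i * powCoeff i n
  *-egfMul-powCoeffPrev zero n = refl
  *-egfMul-powCoeffPrev (suc j) n = refl

  -- The derivative of (1 - e^{-x})^(i+1) is (i+1) (1 - e^{-x})^i e^{-x}, and e^{-x} = 1 - (1 - e^{-x}).
  powCoeff-suc : ∀ i m → powCoeff i (suc m) ≡ + i * (powCoeffPrev i m - powCoeff i m)
  powCoeff-suc zero    m = refl
  powCoeff-suc (suc i) n = begin
    powCoeff (suc i) (suc n)
      ≡⟨ egfMul-suc oneMinusExpNeg (powCoeff i) n ⟩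
    egfMul (oneMinusExpNeg ∘ suc) (powCoeff i) n + egfMul oneMinusExpNeg (powCoeff i ∘ suc) n
      ≡⟨ cong₂ _+_ expNeg-factor chain-factor ⟩
    (powCoeff i n - powCoeff (suc i) n) + + i * (powCoeff i n - powCoeff (suc i) n)
      ≡⟨ solve 2 (λ c u → u :+ c :* u := (con (+ 1) :+ c) :* u) refl (+ i) (powCoeff i n - powCoeff (suc i) n) ⟩
    + suc i * (powCoeff i n - powCoeff (suc i) n) ∎
    where
    expNeg-factor : egfMul (oneMinusExpNeg ∘ suc) (powCoeff i) n ≡ powCoeff i n - powCoeff (suc i) n
    expNeg-factor = begin
      egfMul (oneMinusExpNeg ∘ suc) (powCoeff i) n
        ≡⟨ egfMul-cong {oneMinusExpNeg ∘ suc} {λ m → egfOne m - oneMinusExpNeg m} {powCoeff i} {powCoeff i} n oneMinusExpNeg-suc (λ _ → refl) ⟩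
      egfMul (λ m → egfOne m - oneMinusExpNeg m) (powCoeff i) n
        ≡⟨ egfMul-subˡ egfOne oneMinusExpNeg (powCoeff i) n ⟩
      egfMul egfOne (powCoeff i) n - powCoeff (suc i) n
        ≡⟨ cong (_- powCoeff (suc i) n) (egfMul-identityˡ (powCoeff i) n) ⟩
      powCoeff i n - powCoeff (suc i) n ∎
    chain-factor : egfMul oneMinusExpNeg (powCoeff i ∘ suc) n ≡ + i * (powCoeff i n - powCoeff (suc i) n)
    chain-factor = begin
      egfMul oneMinusExpNeg (powCoeff i ∘ suc) n
        ≡⟨ egfMul-cong {oneMinusExpNeg} {oneMinusExpNeg} {powCoeff i ∘ suc} {λ m → + i * (powCoeffPrev i m - powCoeff i m)} n (λ _ → refl) (powCoeff-suc i) ⟩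
      egfMul oneMinusExpNeg (λ m → + i * (powCoeffPrev i m - powCoeff i m)) n
        ≡⟨ egfMul-scaleʳ oneMinusExpNeg (λ m → powCoeffPrev i m - powCoeff i m) (+ i) n ⟩
      + i * egfMul oneMinusExpNeg (λ m → powCoeffPrev i m - powCoeff i m) n
        ≡⟨ cong (+ i *_) (egfMul-subʳ oneMinusExpNeg (powCoeffPrev i) (powCoeff i) n) ⟩
      + i * (egfMul oneMinusExpNeg (powCoeffPrev i) n - powCoeff (suc i) n)
        ≡⟨ solve 3 (λ c u v → c :* (u :- v) := c :* u :- c :* v) refl (+ i) (egfMul oneMinusExpNeg (powCoeffPrev i) n) (powCoeff (suc i) n) ⟩
      + i * egfMul oneMinusExpNeg (powCoeffPrev i) n - + i * powCoeff (suc i) n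
        ≡⟨ cong (_- + i * powCoeff (suc i) n) (*-egfMul-powCoeffPrev i n) ⟩
      + i * powCoeff i n - + i * powCoeff (suc i) n
        ≡⟨ solve 3 (λ c u v → c :* u :- c :* v := c :* (u :- v)) refl (+ i) (powCoeff i n) (powCoeff (suc i) n) ⟩
      + i * (powCoeff i n - powCoeff (suc i) n) ∎

  powCoeff-vanish : ∀ n i → n < i → powCoeff i n ≡ + 0
  powCoeff-vanish zero (suc i) _ = trans (egfMul≡Σℤ oneMinusExpNeg (powCoeff i) 0) refl
  powCoeff-vanish (suc n) (suc i) (s≤s lt) = begin
    powCoeff (suc i) (suc n) ≡⟨ powCoeff-suc (suc i) n ⟩
    + suc i * (powCoeff i n - powCoeff (suc i) n) ≡⟨ cong₂ (λ u v → + suc i * (u - v)) (powCoeff-vanish n i lt) (powCoeff-vanish n (suc i) (NP.m<n⇒m<1+n lt)) ⟩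
    + suc i * + 0 ≡⟨ ZP.*-zeroʳ (+ suc i) ⟩
    + 0 ∎


  Φ : ℕ → (ℕ → ℤ) → ℤ
  Φ n g = Σℤ (suc n) (λ i → g i * powCoeff i n)

  Φ-cong : ∀ n {g g'} → (∀ i → g i ≡ g' i) → Φ n g ≡ Φ n g'
  Φ-cong n eq = Σℤ-cong (suc n) (λ i → cong (_* powCoeff i n) (eq i))

  Δ : (ℕ → ℤ) → ℕ → ℤ
  Δ g i = + suc i * g (suc i) - + i * g i

  Φ-suc : ∀ n g → Φ (suc n) g ≡ Φ n (Δ g)
  Φ-suc n g = begin
    g 0 * + 0 + Σℤ (suc n) (λ i → g (suc i) * powCoeff (suc i) (suc n))
      ≡⟨ cong₂ _+_ (ZP.*-zeroʳ (g 0)) (Σℤ-cong (suc n) (λ i → trans (cong (g (suc i) *_) (powCoeff-suc (suc i) n))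
           (solve 4 (λ x c u v → x :* (c :* (u :- v)) := (c :* x) :* u :- (c :* x) :* v) refl (g (suc i)) (+ suc i) (powCoeff i n) (powCoeff (suc i) n)))) ⟩
    + 0 + Σℤ (suc n) (λ i → P i - Q i) ≡⟨ ZP.+-identityˡ (Σℤ (suc n) (λ i → P i - Q i)) ⟩
    Σℤ (suc n) (λ i → P i - Q i) ≡⟨ Σℤ-sub (suc n) P Q ⟩
    Σℤ (suc n) P - Σℤ (suc n) Q ≡⟨ cong (λ z → Σℤ (suc n) P - z) Qeq ⟩
    Σℤ (suc n) P - Σℤ (suc n) R ≡⟨ sym (Σℤ-sub (suc n) P R) ⟩
    Σℤ (suc n) (λ i → P i - R i) ≡⟨ Σℤ-cong (suc n) (λ i → solve 3 (λ x y u → x :* u :- y :* u := (x :- y) :* u) refl (+ suc i * g (suc i)) (+ i * g i) (powCoeff i n)) ⟩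
    Φ n (Δ g) ∎
    where
    P Q R : ℕ → ℤ
    P i = (+ suc i * g (suc i)) * powCoeff i n
    Q i = (+ suc i * g (suc i)) * powCoeff (suc i) n
    R i = (+ i * g i) * powCoeff i n
    Qeq : Σℤ (suc n) Q ≡ Σℤ (suc n) R
    Qeq = begin
      Σℤ (suc n) Q ≡⟨ sym (ZP.+-identityˡ (Σℤ (suc n) Q)) ⟩
      Σℤ (suc (suc n)) R ≡⟨ Σℤ-last (suc n) R ⟩
      Σℤ (suc n) R + (+ suc n * g (suc n)) * powCoeff (suc n) n
        ≡⟨ cong (λ z → Σℤ (suc n) R + (+ suc n * g (suc n)) * z) (powCoeff-vanish n (suc n) (NP.n<1+n n)) ⟩
      Σℤ (suc n) R + (+ suc n * g (suc n)) * + 0 ≡⟨ cong (λ z → Σℤ (suc n) R + z) (ZP.*-zeroʳ (+ suc n * g (suc n))) ⟩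
      Σℤ (suc n) R + + 0 ≡⟨ ZP.+-identityʳ (Σℤ (suc n) R) ⟩
      Σℤ (suc n) R ∎

  Ψ : ℕ → (ℕ → ℤ) → ℤ
  Ψ n h = Σℤ (suc n) (λ r → + surj n r * h r)

  Ψ-cong : ∀ n {h h'} → (∀ i → h i ≡ h' i) → Ψ n h ≡ Ψ n h'
  Ψ-cong n eq = Σℤ-cong (suc n) (λ i → cong (+ surj n i *_) (eq i))

  E : (ℕ → ℤ) → ℕ → ℤ
  E h r = + r * h r + + suc r * h (suc r)

  Ψ-suc : ∀ n h → Ψ (suc n) h ≡ Ψ n (E h)
  Ψ-suc n h = begin
    + surj (suc n) 0 * h 0 + Σℤ (suc n) (λ r → + surj (suc n) (suc r) * h (suc r))
      ≡⟨ cong₂ _+_ (cong (λ z → + z * h 0) (surj-suc-0 n)) (Σℤ-cong (suc n) (λ r → trans (cong (λ z → + z * h (suc r)) (surj-suc-suc n r))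
          (trans (cong (_* h (suc r)) (ZP.pos-* (suc r) (surj n (suc r) ℕ.+ surj n r)))
          (solve 4 (λ c x y u → (c :* (x :+ y)) :* u := x :* (c :* u) :+ y :* (c :* u)) refl (+ suc r) (+ surj n (suc r)) (+ surj n r) (h (suc r)))))) ⟩
    + 0 + Σℤ (suc n) (λ r → W (suc r) + V r) ≡⟨ ZP.+-identityˡ (Σℤ (suc n) (λ r → W (suc r) + V r)) ⟩
    Σℤ (suc n) (λ r → W (suc r) + V r) ≡⟨ Σℤ-+ (suc n) (W ∘ suc) V ⟩
    Σℤ (suc n) (W ∘ suc) + Σℤ (suc n) V ≡⟨ cong (λ z → z + Σℤ (suc n) V) Weq ⟩
    Σℤ (suc n) W + Σℤ (suc n) V ≡⟨ sym (Σℤ-+ (suc n) W V) ⟩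
    Σℤ (suc n) (λ r → W r + V r) ≡⟨ Σℤ-cong (suc n) (λ r → sym (ZP.*-distribˡ-+ (+ surj n r) (+ r * h r) (+ suc r * h (suc r)))) ⟩
    Ψ n (E h) ∎
    where
    W V : ℕ → ℤ
    W r = + surj n r * (+ r * h r)
    V r = + surj n r * (+ suc r * h (suc r))
    Weq : Σℤ (suc n) (W ∘ suc) ≡ Σℤ (suc n) W
    Weq = begin
      Σℤ (suc n) (W ∘ suc) ≡⟨ sym (ZP.+-identityˡ (Σℤ (suc n) (W ∘ suc))) ⟩
      + 0 + Σℤ (suc n) (W ∘ suc) ≡⟨ cong (λ z → z + Σℤ (suc n) (W ∘ suc)) (sym (trans (cong (+ surj n 0 *_) (ZP.*-zeroˡ (h 0))) (ZP.*-zeroʳ (+ surj n 0)))) ⟩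
      Σℤ (suc (suc n)) W ≡⟨ Σℤ-last (suc n) W ⟩
      Σℤ (suc n) W + W (suc n) ≡⟨ cong (λ z → Σℤ (suc n) W + + z * (+ suc n * h (suc n))) (surj-vanish n (suc n) (NP.n<1+n n)) ⟩
      Σℤ (suc n) W + + 0 ≡⟨ ZP.+-identityʳ (Σℤ (suc n) W) ⟩
      Σℤ (suc n) W ∎

  binomTransform : (ℕ → ℤ) → ℕ → ℤ
  binomTransform h i = Σℤ (suc i) (λ r → + binom i r * h r)

  pairSumℤ : (ℕ → ℤ) → ℕ → ℤ
  pairSumℤ h zero = h zero
  pairSumℤ h (suc r) = h (suc r) + h r

  E₊ : (ℕ → ℤ) → ℕ → ℤ
  E₊ h r = E h r + h r

  binom-suc-absorb : ∀ i r → suc i ℕ.* binom (suc i) (suc r) ≡ binom i (suc r) ℕ.* (suc i ℕ.+ suc r) ℕ.+ suc r ℕ.* binom i r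
  binom-suc-absorb i r = begin
    suc i ℕ.* (B0 ℕ.+ B1) ≡⟨ NS.solve 4 (λ i r B0 B1 → (NS.con 1 NS.:+ i) NS.:* (B0 NS.:+ B1) NS.:= B0 NS.:+ B1 NS.:+ i NS.:* B1 NS.:+ i NS.:* B0) refl i r B0 B1 ⟩
    B0 ℕ.+ B1 ℕ.+ i ℕ.* B1 ℕ.+ i ℕ.* B0 ≡⟨ cong (λ z → B0 ℕ.+ B1 ℕ.+ i ℕ.* B1 ℕ.+ z) (sym (binom-absorb i r)) ⟩
    B0 ℕ.+ B1 ℕ.+ i ℕ.* B1 ℕ.+ (suc r ℕ.* B1 ℕ.+ r ℕ.* B0)
      ≡⟨ NS.solve 4 (λ i r B0 B1 → B0 NS.:+ B1 NS.:+ i NS.:* B1 NS.:+ ((NS.con 1 NS.:+ r) NS.:* B1 NS.:+ r NS.:* B0)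
          NS.:= B1 NS.:* ((NS.con 1 NS.:+ i) NS.:+ (NS.con 1 NS.:+ r)) NS.:+ (NS.con 1 NS.:+ r) NS.:* B0) refl i r B0 B1 ⟩
    binom i (suc r) ℕ.* (suc i ℕ.+ suc r) ℕ.+ suc r ℕ.* binom i r ∎
    where
    B0 = binom i r
    B1 = binom i (suc r)

  binomTransform-suc : ∀ h i → + suc i * binomTransform h (suc i) ≡ binomTransform (E₊ h) i + + i * binomTransform h i
  binomTransform-suc h i = begin
    + suc i * (+ 1 * h 0 + Σℤ (suc i) (λ r → + binom (suc i) (suc r) * h (suc r)))
      ≡⟨ ZP.*-distribˡ-+ (+ suc i) (+ 1 * h 0) (Σℤ (suc i) (λ r → + binom (suc i) (suc r) * h (suc r))) ⟩
    + suc i * (+ 1 * h 0) + + suc i * Σℤ (suc i) (λ r → + binom (suc i) (suc r) * h (suc r))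
      ≡⟨ cong₂ _+_ (cong (+ suc i *_) (ZP.*-identityˡ (h 0))) (Σℤ-*l (suc i) (+ suc i) (λ r → + binom (suc i) (suc r) * h (suc r))) ⟩
    + suc i * h 0 + Σℤ (suc i) (λ r → + suc i * (+ binom (suc i) (suc r) * h (suc r)))
      ≡⟨ cong (λ z → + suc i * h 0 + z) (Σℤ-cong (suc i) perS) ⟩
    + suc i * h 0 + Σℤ (suc i) (λ r → U (suc r) + V r)
      ≡⟨ cong (λ z → + suc i * h 0 + z) (Σℤ-+ (suc i) (U ∘ suc) V) ⟩
    + suc i * h 0 + (Σℤ (suc i) (U ∘ suc) + Σℤ (suc i) V)
      ≡⟨ cong (λ z → + suc i * h 0 + (z + Σℤ (suc i) V)) (trans (Σℤ-last i (U ∘ suc)) (trans (cong (λ z → Σℤ i (U ∘ suc) + z) lastU) (ZP.+-identityʳ (Σℤ i (U ∘ suc))))) ⟩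
    + suc i * h 0 + (Σℤ i (U ∘ suc) + Σℤ (suc i) V)
      ≡⟨ sym (ZP.+-assoc (+ suc i * h 0) (Σℤ i (U ∘ suc)) (Σℤ (suc i) V)) ⟩
    (+ suc i * h 0 + Σℤ i (U ∘ suc)) + Σℤ (suc i) V
      ≡⟨ cong (λ z → (z + Σℤ i (U ∘ suc)) + Σℤ (suc i) V) (cong (λ z → + z * h 0) (sym (trans (NP.*-identityˡ (suc i ℕ.+ 0)) (NP.+-identityʳ (suc i))))) ⟩
    Σℤ (suc i) U + Σℤ (suc i) V ≡⟨ sym (Σℤ-+ (suc i) U V) ⟩
    Σℤ (suc i) (λ r → U r + V r) ≡⟨ sym (Σℤ-cong (suc i) perR) ⟩
    Σℤ (suc i) (λ r → + binom i r * E₊ h r + + i * (+ binom i r * h r))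
      ≡⟨ Σℤ-+ (suc i) (λ r → + binom i r * E₊ h r) (λ r → + i * (+ binom i r * h r)) ⟩
    binomTransform (E₊ h) i + Σℤ (suc i) (λ r → + i * (+ binom i r * h r))
      ≡⟨ cong (λ z → binomTransform (E₊ h) i + z) (sym (Σℤ-*l (suc i) (+ i) (λ r → + binom i r * h r))) ⟩
    binomTransform (E₊ h) i + + i * binomTransform h i ∎
    where
    U V : ℕ → ℤ
    U r = + (binom i r ℕ.* (suc i ℕ.+ r)) * h r
    V r = + (suc r ℕ.* binom i r) * h (suc r)
    perR : ∀ r → + binom i r * E₊ h r + + i * (+ binom i r * h r) ≡ U r + V r
    perR r = begin
      + binom i r * E₊ h r + + i * (+ binom i r * h r)
        ≡⟨ solve 5 (λ b R I x y → b :* ((R :* x :+ (con (+ 1) :+ R) :* y) :+ x) :+ I :* (b :* x)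
              := (b :* ((con (+ 1) :+ I) :+ R)) :* x :+ ((con (+ 1) :+ R) :* b) :* y) refl (+ binom i r) (+ r) (+ i) (h r) (h (suc r)) ⟩
      (+ binom i r * (+ suc i + + r)) * h r + (+ suc r * + binom i r) * h (suc r)
        ≡⟨ sym (cong₂ (λ u v → u * h r + v * h (suc r)) (ZP.pos-* (binom i r) (suc i ℕ.+ r)) (ZP.pos-* (suc r) (binom i r))) ⟩
      U r + V r ∎
    lastU : U (suc i) ≡ + 0
    lastU = trans (cong (λ z → + (z ℕ.* (suc i ℕ.+ suc i)) * h (suc i)) (binom-vanish i (suc i) (NP.n<1+n i))) refl
    perS : ∀ r → + suc i * (+ binom (suc i) (suc r) * h (suc r)) ≡ U (suc r) + V r
    perS r = begin
      + suc i * (+ binom (suc i) (suc r) * h (suc r)) ≡⟨ sym (ZP.*-assoc (+ suc i) (+ binom (suc i) (suc r)) (h (suc r))) ⟩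
      (+ suc i * + binom (suc i) (suc r)) * h (suc r) ≡⟨ cong (_* h (suc r)) (sym (ZP.pos-* (suc i) (binom (suc i) (suc r)))) ⟩
      + (suc i ℕ.* binom (suc i) (suc r)) * h (suc r) ≡⟨ cong (λ z → + z * h (suc r)) (binom-suc-absorb i r) ⟩
      (+ (binom i (suc r) ℕ.* (suc i ℕ.+ suc r)) + + (suc r ℕ.* binom i r)) * h (suc r)
        ≡⟨ ZP.*-distribʳ-+ (h (suc r)) (+ (binom i (suc r) ℕ.* (suc i ℕ.+ suc r))) (+ (suc r ℕ.* binom i r)) ⟩
      U (suc r) + V r ∎

  Δ-binomTransform : ∀ h i → Δ (binomTransform h) i ≡ binomTransform (E₊ h) i
  Δ-binomTransform h i = begin
    + suc i * binomTransform h (suc i) - + i * binomTransform h i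
      ≡⟨ cong (_- + i * binomTransform h i) (binomTransform-suc h i) ⟩
    (binomTransform (E₊ h) i + + i * binomTransform h i) - + i * binomTransform h i
      ≡⟨ solve 2 (λ x y → (x :+ y) :- y := x) refl (binomTransform (E₊ h) i) (+ i * binomTransform h i) ⟩
    binomTransform (E₊ h) i ∎

  pairSumℤ-E₊ : ∀ h r → pairSumℤ (E₊ h) r ≡ E (pairSumℤ h) r
  pairSumℤ-E₊ h zero = solve 2 (λ x y → (con (+ 0) :* x :+ con (+ 1) :* y) :+ x := con (+ 0) :* x :+ con (+ 1) :* (y :+ x)) refl (h 0) (h 1)
  pairSumℤ-E₊ h (suc r) = solve 4 (λ R x y z → ((con (+ 1) :+ R) :* y :+ (con (+ 2) :+ R) :* z :+ y) :+ (R :* x :+ (con (+ 1) :+ R) :* y :+ x)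
     := (con (+ 1) :+ R) :* (y :+ x) :+ (con (+ 2) :+ R) :* (z :+ y)) refl (+ r) (h r) (h (suc r)) (h (suc (suc r)))

  -- Φ and Ψ obey recurrences in n (Φ-suc, Ψ-suc) that the binomial transform intertwines.
  Φ≡Ψ : ∀ n h → Φ n (binomTransform h) ≡ Ψ n (pairSumℤ h)
  Φ≡Ψ zero h = begin
    (+ 1 * h 0 + + 0) * + 1 + + 0 ≡⟨ solve 1 (λ x → (con (+ 1) :* x :+ con (+ 0)) :* con (+ 1) :+ con (+ 0) := con (+ 1) :* x :+ con (+ 0)) refl (h 0) ⟩
    + 1 * h 0 + + 0 ≡⟨ cong (λ z → + z * h 0 + + 0) (sym surj-0-0) ⟩
    + surj 0 0 * h 0 + + 0 ∎
  Φ≡Ψ (suc n) h = begin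
    Φ (suc n) (binomTransform h) ≡⟨ Φ-suc n (binomTransform h) ⟩
    Φ n (Δ (binomTransform h)) ≡⟨ Φ-cong n (Δ-binomTransform h) ⟩
    Φ n (binomTransform (E₊ h)) ≡⟨ Φ≡Ψ n (E₊ h) ⟩
    Ψ n (pairSumℤ (E₊ h)) ≡⟨ Ψ-cong n (pairSumℤ-E₊ h) ⟩
    Ψ n (E (pairSumℤ h)) ≡⟨ sym (Ψ-suc n (pairSumℤ h)) ⟩
    Ψ (suc n) (pairSumℤ h) ∎


  surjAdjPrev : ℕ → ℕ → ℕ
  surjAdjPrev k zero = 0
  surjAdjPrev k (suc r) = surjAdj k r

  surjAdj-suc : ∀ k r → surjAdj (suc k) r ≡ r ℕ.* surjAdjPrev k r ℕ.+ suc r ℕ.* surjAdj k r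
  surjAdj-suc k zero = begin
    surj (suc k) 0 ℕ.+ surj (suc k) 1 ≡⟨ cong₂ ℕ._+_ (surj-suc-0 k) (surj-suc-suc k 0) ⟩
    0 ℕ.+ 1 ℕ.* (surj k 1 ℕ.+ surj k 0) ≡⟨ NS.solve 2 (λ x y → NS.con 0 NS.:+ NS.con 1 NS.:* (x NS.:+ y) NS.:= NS.con 0 NS.:+ NS.con 1 NS.:* (y NS.:+ x)) refl (surj k 1) (surj k 0) ⟩
    0 ℕ.+ 1 ℕ.* surjAdj k 0 ∎
  surjAdj-suc k (suc r) = begin
    surj (suc k) (suc r) ℕ.+ surj (suc k) (suc (suc r)) ≡⟨ cong₂ ℕ._+_ (surj-suc-suc k r) (surj-suc-suc k (suc r)) ⟩
    suc r ℕ.* (surj k (suc r) ℕ.+ surj k r) ℕ.+ suc (suc r) ℕ.* (surj k (suc (suc r)) ℕ.+ surj k (suc r))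
      ≡⟨ NS.solve 4 (λ R x y z → (NS.con 1 NS.:+ R) NS.:* (y NS.:+ x) NS.:+ (NS.con 2 NS.:+ R) NS.:* (z NS.:+ y)
          NS.:= (NS.con 1 NS.:+ R) NS.:* (x NS.:+ y) NS.:+ (NS.con 2 NS.:+ R) NS.:* (y NS.:+ z)) refl r (surj k r) (surj k (suc r)) (surj k (suc (suc r))) ⟩
    suc r ℕ.* surjAdjPrev k (suc r) ℕ.+ suc (suc r) ℕ.* surjAdj k (suc r) ∎

  binomTransformℕ : (ℕ → ℕ) → ℕ → ℕ
  binomTransformℕ h i = Σ< (suc i) (λ r → binom i r ℕ.* h r)

  -- (i+1)^k = Σ_s C(i+1,s) s! S(k,s), with C(i+1,s) split by Pascal's rule.
  binomTransform-surjAdj : ∀ k i → binomTransformℕ (surjAdj k) i ≡ suc i ^ k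
  binomTransform-surjAdj zero i = begin
    1 ℕ.* (surj 0 0 ℕ.+ surj 0 1) ℕ.+ Σ< i (λ r → binom i (suc r) ℕ.* (surj 0 (suc r) ℕ.+ surj 0 (suc (suc r))))
      ≡⟨ cong₂ (λ u v → 1 ℕ.* (u ℕ.+ v) ℕ.+ Σ< i (λ r → binom i (suc r) ℕ.* (surj 0 (suc r) ℕ.+ surj 0 (suc (suc r))))) surj-0-0 (surj-0-suc 0) ⟩
    1 ℕ.+ Σ< i (λ r → binom i (suc r) ℕ.* (surj 0 (suc r) ℕ.+ surj 0 (suc (suc r))))
      ≡⟨ cong (1 ℕ.+_) (Σ<-vanish i _ (λ r _ → trans (cong₂ (λ u v → binom i (suc r) ℕ.* (u ℕ.+ v)) (surj-0-suc r) (surj-0-suc (suc r))) (NP.*-zeroʳ (binom i (suc r))))) ⟩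
    1 ∎
  binomTransform-surjAdj (suc k) i = begin
    Σ< (suc i) (λ r → binom i r ℕ.* surjAdj (suc k) r)
      ≡⟨ Σ<-cong (suc i) (λ r → trans (cong (binom i r ℕ.*_) (surjAdj-suc k r)) (NP.*-distribˡ-+ (binom i r) (r ℕ.* surjAdjPrev k r) (suc r ℕ.* surjAdj k r))) ⟩
    Σ< (suc i) (λ r → binom i r ℕ.* (r ℕ.* surjAdjPrev k r) ℕ.+ binom i r ℕ.* (suc r ℕ.* surjAdj k r))
      ≡⟨ Σ<-+ (suc i) (λ r → binom i r ℕ.* (r ℕ.* surjAdjPrev k r)) (λ r → binom i r ℕ.* (suc r ℕ.* surjAdj k r)) ⟩
    (1 ℕ.* (0 ℕ.* 0) ℕ.+ Σ< i (λ r → binom i (suc r) ℕ.* (suc r ℕ.* surjAdj k r))) ℕ.+ Σ< (suc i) (λ r → binom i r ℕ.* (suc r ℕ.* surjAdj k r))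
      ≡⟨ cong (ℕ._+ Σ< (suc i) (λ r → binom i r ℕ.* (suc r ℕ.* surjAdj k r))) ext ⟩
    Σ< (suc i) (λ r → binom i (suc r) ℕ.* (suc r ℕ.* surjAdj k r)) ℕ.+ Σ< (suc i) (λ r → binom i r ℕ.* (suc r ℕ.* surjAdj k r))
      ≡⟨ sym (Σ<-+ (suc i) (λ r → binom i (suc r) ℕ.* (suc r ℕ.* surjAdj k r)) (λ r → binom i r ℕ.* (suc r ℕ.* surjAdj k r))) ⟩
    Σ< (suc i) (λ r → binom i (suc r) ℕ.* (suc r ℕ.* surjAdj k r) ℕ.+ binom i r ℕ.* (suc r ℕ.* surjAdj k r))
      ≡⟨ Σ<-cong (suc i) per ⟩
    Σ< (suc i) (λ r → suc i ℕ.* (binom i r ℕ.* surjAdj k r))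
      ≡⟨ sym (Σ<-*l (suc i) (suc i) (λ r → binom i r ℕ.* surjAdj k r)) ⟩
    suc i ℕ.* binomTransformℕ (surjAdj k) i ≡⟨ cong (suc i ℕ.*_) (binomTransform-surjAdj k i) ⟩
    suc i ^ suc k ∎
    where
    ext : 1 ℕ.* (0 ℕ.* 0) ℕ.+ Σ< i (λ r → binom i (suc r) ℕ.* (suc r ℕ.* surjAdj k r)) ≡ Σ< (suc i) (λ r → binom i (suc r) ℕ.* (suc r ℕ.* surjAdj k r))
    ext = sym (trans (Σ<-last i (λ r → binom i (suc r) ℕ.* (suc r ℕ.* surjAdj k r)))
            (trans (cong (λ z → Σ< i (λ r → binom i (suc r) ℕ.* (suc r ℕ.* surjAdj k r)) ℕ.+ z ℕ.* (suc i ℕ.* surjAdj k i)) (binom-vanish i (suc i) (NP.n<1+n i)))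
              (NP.+-identityʳ _)))
    per : ∀ r → binom i (suc r) ℕ.* (suc r ℕ.* surjAdj k r) ℕ.+ binom i r ℕ.* (suc r ℕ.* surjAdj k r) ≡ suc i ℕ.* (binom i r ℕ.* surjAdj k r)
    per r = begin
      binom i (suc r) ℕ.* (suc r ℕ.* surjAdj k r) ℕ.+ binom i r ℕ.* (suc r ℕ.* surjAdj k r)
        ≡⟨ NS.solve 4 (λ b1 b0 R h → b1 NS.:* ((NS.con 1 NS.:+ R) NS.:* h) NS.:+ b0 NS.:* ((NS.con 1 NS.:+ R) NS.:* h)
            NS.:= ((NS.con 1 NS.:+ R) NS.:* b1 NS.:+ R NS.:* b0 NS.:+ b0) NS.:* h) refl (binom i (suc r)) (binom i r) r (surjAdj k r) ⟩
      (suc r ℕ.* binom i (suc r) ℕ.+ r ℕ.* binom i r ℕ.+ binom i r) ℕ.* surjAdj k r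
        ≡⟨ cong (λ z → (z ℕ.+ binom i r) ℕ.* surjAdj k r) (binom-absorb i r) ⟩
      (i ℕ.* binom i r ℕ.+ binom i r) ℕ.* surjAdj k r
        ≡⟨ NS.solve 3 (λ i b h → (i NS.:* b NS.:+ b) NS.:* h NS.:= (NS.con 1 NS.:+ i) NS.:* (b NS.:* h)) refl i (binom i r) (surjAdj k r) ⟩
      suc i ℕ.* (binom i r ℕ.* surjAdj k r) ∎

  binomTransform-+ : ∀ h i → binomTransform (λ r → + h r) i ≡ + binomTransformℕ h i
  binomTransform-+ h i = trans (Σℤ-cong (suc i) (λ r → sym (ZP.pos-* (binom i r) (h r)))) (sym (+Σ<≡Σℤ (suc i) (λ r → binom i r ℕ.* h r)))

  pairSumℤ-+ : ∀ h r → pairSumℤ (λ r → + h r) r ≡ + pairSum h r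
  pairSumℤ-+ h zero = refl
  pairSumℤ-+ h (suc r) = refl

  polyBernoulli≡callanCount : ∀ n k → polyBernoulli n k ≡ + callanCount n k
  polyBernoulli≡callanCount n k = begin
    polyBernoulli n k ≡⟨ sumToℤ≡Σℤ n (λ i → + (suc i ^ k) * egfPow oneMinusExpNeg i n) ⟩
    Φ n (λ i → + (suc i ^ k)) ≡⟨ Φ-cong n (λ i → sym (trans (binomTransform-+ (surjAdj k) i) (cong +_ (binomTransform-surjAdj k i)))) ⟩
    Φ n (binomTransform (λ r → + surjAdj k r)) ≡⟨ Φ≡Ψ n (λ r → + surjAdj k r) ⟩
    Ψ n (pairSumℤ (λ r → + surjAdj k r)) ≡⟨ Ψ-cong n (pairSumℤ-+ (surjAdj k)) ⟩
    Ψ n (λ r → + pairSum (surjAdj k) r) ≡⟨ Σℤ-cong (suc n) (λ r → sym (ZP.pos-* (surj n r) (pairSum (surjAdj k) r))) ⟩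
    Σℤ (suc n) (λ r → + (surj n r ℕ.* pairSum (surjAdj k) r)) ≡⟨ sym (+Σ<≡Σℤ (suc n) (λ r → surj n r ℕ.* pairSum (surjAdj k) r)) ⟩
    + callanCount n k ∎


module Splits where

  open import Data.Nat as ℕ using (ℕ; _<_)
  open import Data.Nat.Properties using (<-irrefl; <-trans)
  open import Data.Empty using (⊥; ⊥-elim)
  open import Data.Unit using (⊤; tt)
  open import Data.Sum using (inj₁; inj₂)
  open import Data.Product using (_×_; _,_; proj₁; proj₂; ∃; map₁; map₂; uncurry)
  open import Data.List using (List; []; _∷_; _++_; map)
  open import Data.List.Relation.Unary.All as All using (All; []; _∷_)
  open import Data.List.Relation.Unary.AllPairs using (AllPairs; []; _∷_)
  open import Data.List.Relation.Unary.Any using (here; there)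
  open import Data.List.Membership.Propositional using (_∈_)
  open import Data.List.Membership.Propositional.Properties using (∈-map⁺; ∈-map⁻; ∈-++⁺ˡ; ∈-++⁺ʳ; ∈-++⁻)
  open import Data.List.Relation.Ternary.Interleaving.Propositional using (Interleaving; []; consˡ; consʳ)
  open import Relation.Binary.PropositionalEquality

  NonEmpty : List ℕ → Set
  NonEmpty []      = ⊥
  NonEmpty (_ ∷ _) = ⊤

  splits : List ℕ → List (List ℕ × List ℕ)
  splits []       = ([] , []) ∷ []
  splits (x ∷ xs) = map (map₁ (x ∷_)) (splits xs) ++ map (map₂ (x ∷_)) (splits xs)

  splits⁺ : List ℕ → List (List ℕ × List ℕ)
  splits⁺ []       = []
  splits⁺ (x ∷ xs) = map (map₁ (x ∷_)) (splits xs) ++ map (map₂ (x ∷_)) (splits⁺ xs)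

  splits-sound : ∀ A {p} → p ∈ splits A → Interleaving (proj₁ p) (proj₂ p) A
  splits-sound []      (here refl) = []
  splits-sound (x ∷ A) mem with ∈-++⁻ (map (map₁ (x ∷_)) (splits A)) mem
  ... | inj₁ m with ∈-map⁻ (map₁ (x ∷_)) m
  ...   | q , q∈ , refl = consˡ (splits-sound A q∈)
  splits-sound (x ∷ A) mem | inj₂ m with ∈-map⁻ (map₂ (x ∷_)) m
  ...   | q , q∈ , refl = consʳ (splits-sound A q∈)

  splits⁺-sound : ∀ A {p} → p ∈ splits⁺ A → Interleaving (proj₁ p) (proj₂ p) A × NonEmpty (proj₁ p)
  splits⁺-sound (x ∷ A) mem with ∈-++⁻ (map (map₁ (x ∷_)) (splits A)) mem
  ... | inj₁ m with ∈-map⁻ (map₁ (x ∷_)) m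
  ...   | q , q∈ , refl = consˡ (splits-sound A q∈) , tt
  splits⁺-sound (x ∷ A) mem | inj₂ m with ∈-map⁻ (map₂ (x ∷_)) m
  ...   | q , q∈ , refl with splits⁺-sound A q∈
  ...     | sp , ne = consʳ sp , ne

  splits-complete : ∀ {A s r} → Interleaving s r A → (s , r) ∈ splits A
  splits-complete []                   = here refl
  splits-complete {x ∷ A} (consˡ sp) = ∈-++⁺ˡ (∈-map⁺ (map₁ (x ∷_)) (splits-complete sp))
  splits-complete {x ∷ A} (consʳ sp) = ∈-++⁺ʳ (map (map₁ (x ∷_)) (splits A)) (∈-map⁺ (map₂ (x ∷_)) (splits-complete sp))

  splits⁺-complete : ∀ {A s r} → Interleaving s r A → NonEmpty s → (s , r) ∈ splits⁺ A
  splits⁺-complete {x ∷ A} (consˡ sp) ne = ∈-++⁺ˡ (∈-map⁺ (map₁ (x ∷_)) (splits-complete sp))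
  splits⁺-complete {x ∷ A} (consʳ sp) ne = ∈-++⁺ʳ (map (map₁ (x ∷_)) (splits A)) (∈-map⁺ (map₂ (x ∷_)) (splits⁺-complete sp ne))

  All-interleaving⁻ : ∀ {P : ℕ → Set} {A s r} → All P A → Interleaving s r A → All P s × All P r
  All-interleaving⁻ []         []         = [] , []
  All-interleaving⁻ (px ∷ pa) (consˡ sp) = let (ps , pr) = All-interleaving⁻ pa sp in px ∷ ps , pr
  All-interleaving⁻ (px ∷ pa) (consʳ sp) = let (ps , pr) = All-interleaving⁻ pa sp in ps , px ∷ pr

  sorted-interleaving⁻ : ∀ {A s r} → AllPairs _<_ A → Interleaving s r A → AllPairs _<_ s × AllPairs _<_ r
  sorted-interleaving⁻ []         []         = [] , []
  sorted-interleaving⁻ (px ∷ pa) (consˡ sp) =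
    let (ss , sr) = sorted-interleaving⁻ pa sp in proj₁ (All-interleaving⁻ px sp) ∷ ss , sr
  sorted-interleaving⁻ (px ∷ pa) (consʳ sp) =
    let (ss , sr) = sorted-interleaving⁻ pa sp in ss , proj₂ (All-interleaving⁻ px sp) ∷ sr

  <-head : ∀ {x s s'} → All (x <_) s → s ≡ x ∷ s' → ⊥
  <-head (x<x ∷ _) refl = <-irrefl refl x<x

  interleaving-complement : ∀ {A s r r'} → AllPairs _<_ A → Interleaving s r A → Interleaving s r' A → r ≡ r'
  interleaving-complement []         []         []          = refl
  interleaving-complement (px ∷ pa) (consˡ sp) (consˡ sp') = interleaving-complement pa sp sp'
  interleaving-complement (px ∷ pa) (consʳ sp) (consʳ sp') = cong (_ ∷_) (interleaving-complement pa sp sp')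
  interleaving-complement (px ∷ pa) (consˡ sp) (consʳ sp') = ⊥-elim (<-head (proj₁ (All-interleaving⁻ px sp')) refl)
  interleaving-complement (px ∷ pa) (consʳ sp) (consˡ sp') = ⊥-elim (<-head (proj₁ (All-interleaving⁻ px sp)) refl)

  ∈-tail : ∀ {a z : ℕ} {A} → a < z → z ∈ a ∷ A → z ∈ A
  ∈-tail a<z (here refl)  = ⊥-elim (<-irrefl refl a<z)
  ∈-tail _   (there z∈A) = z∈A

  interleaving-exists : ∀ {A s} → AllPairs _<_ A → AllPairs _<_ s → All (_∈ A) s → ∃ λ r → Interleaving s r A
  interleaving-exists {[]}    {[]}    _ _ _       = [] , []
  interleaving-exists {[]}    {y ∷ s} _ _ (() ∷ _)
  interleaving-exists {a ∷ A} {[]}    (_ ∷ pA) _ _ =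
    let (r , sp) = interleaving-exists pA [] [] in a ∷ r , consʳ sp
  interleaving-exists {a ∷ A} {y ∷ s} (_ ∷ pA) (y<s ∷ ps) (here refl ∷ s∈) =
    let (r , sp) = interleaving-exists pA ps (All.zipWith (uncurry ∈-tail) (y<s , s∈)) in r , consˡ sp
  interleaving-exists {a ∷ A} {y ∷ s} (a<A ∷ pA) (y<s ∷ ps) (there y∈A ∷ s∈) =
    let a<y = All.lookup a<A y∈A
        (r , sp) = interleaving-exists pA (y<s ∷ ps)
                     (y∈A ∷ All.zipWith (uncurry (λ y<z → ∈-tail (<-trans a<y y<z))) (y<s , s∈))
    in a ∷ r , consʳ sp

module RunWords where

  open import Data.Nat as ℕ using (ℕ; zero; suc; _+_; _*_; _≤_; s≤s)
  open import Data.Nat.Properties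
  open import Data.Product using (_,_; proj₁; proj₂; map₁; map₂)
  open import Data.List using (List; []; _∷_; _++_; map; concatMap; length)
  open import Data.List.Properties using (length-map; length-++)
  open import Data.List.Relation.Unary.All as All using (All)
  open import Data.List.Relation.Ternary.Interleaving.Properties using (interleave-length)
  open import Data.List.Relation.Ternary.Interleaving.Propositional using (Interleaving)
  open import Relation.Binary.PropositionalEquality
  open ≡-Reasoning
  open ℕSums
  open Surjections
  open AlternatingCounts
  open Splits

  -- loWords f A B lists the words over the sorted letter sets A (small) and B (large)
  -- built from alternating nonempty increasing runs, the first run (if any) small;
  -- hiWords is the same with a large first run. The fuel f bounds the number of runs.
  mutual
    loWords⁺ : ℕ → List ℕ → List ℕ → List (List ℕ)
    loWords⁺ zero    A B = []
    loWords⁺ (suc f) A B = concatMap (λ p → map (proj₁ p ++_) (hiWords f (proj₂ p) B)) (splits⁺ A)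

    hiWords⁺ : ℕ → List ℕ → List ℕ → List (List ℕ)
    hiWords⁺ zero    A B = []
    hiWords⁺ (suc f) A B = concatMap (λ p → map (proj₁ p ++_) (loWords f A (proj₂ p))) (splits⁺ B)

    loWords : ℕ → List ℕ → List ℕ → List (List ℕ)
    loWords f []      []      = [] ∷ []
    loWords f []      (b ∷ B) = []
    loWords f (a ∷ A) B       = loWords⁺ f (a ∷ A) B

    hiWords : ℕ → List ℕ → List ℕ → List (List ℕ)
    hiWords f []      []      = [] ∷ []
    hiWords f A       (b ∷ B) = hiWords⁺ f A (b ∷ B)
    hiWords f (a ∷ A) []      = []

  length-concatMap : ∀ {A B : Set} (g : A → List B) xs → length (concatMap g xs) ≡ Σ∈ xs (λ x → length (g x))
  length-concatMap g []       = refl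
  length-concatMap g (x ∷ xs) = trans (length-++ (g x)) (cong (length (g x) +_) (length-concatMap g xs))

  Σ<-pascal : ∀ a m (g : ℕ → ℕ) → Σ< m (λ i → binom a (suc i) * g (suc i)) + Σ< m (λ i → binom a i * g (suc i))
                                    ≡ Σ< m (λ i → binom (suc a) (suc i) * g (suc i))
  Σ<-pascal a m g = trans (sym (Σ<-+ m _ _)) (Σ<-cong m (λ i →
    trans (sym (*-distribʳ-+ (g (suc i)) (binom a (suc i)) (binom a i)))
          (cong (_* g (suc i)) (+-comm (binom a (suc i)) (binom a i)))))

  -- Pascal's rule, applied to the choice of the first letter.
  Σ∈-splits : ∀ xs (g : ℕ → ℕ) →
    Σ∈ (splits xs) (λ p → g (length (proj₂ p))) ≡ Σ< (suc (length xs)) (λ i → binom (length xs) i * g i)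
  Σ∈-splits []       g = cong (_+ 0) (sym (+-identityʳ (g 0)))
  Σ∈-splits (x ∷ xs) g = begin
    Σ∈ (map (map₁ (x ∷_)) (splits xs) ++ map (map₂ (x ∷_)) (splits xs)) G
      ≡⟨ Σ∈-++ (map (map₁ (x ∷_)) (splits xs)) (map (map₂ (x ∷_)) (splits xs)) G ⟩
    Σ∈ (map (map₁ (x ∷_)) (splits xs)) G + Σ∈ (map (map₂ (x ∷_)) (splits xs)) G
      ≡⟨ cong₂ _+_ (Σ∈-map (map₁ (x ∷_)) (splits xs) G) (Σ∈-map (map₂ (x ∷_)) (splits xs) G) ⟩
    Σ∈ (splits xs) G + Σ∈ (splits xs) (λ p → g (suc (length (proj₂ p))))
      ≡⟨ cong₂ _+_ (Σ∈-splits xs g) (Σ∈-splits xs (λ i → g (suc i))) ⟩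
    (1 * g 0 + Σ< a (λ i → binom a (suc i) * g (suc i))) + Σ< (suc a) (λ i → binom a i * g (suc i))
      ≡⟨ cong (λ t → (1 * g 0 + t) + Σ< (suc a) (λ i → binom a i * g (suc i))) (sym lastTerm) ⟩
    (1 * g 0 + Σ< (suc a) (λ i → binom a (suc i) * g (suc i))) + Σ< (suc a) (λ i → binom a i * g (suc i))
      ≡⟨ +-assoc (1 * g 0) _ _ ⟩
    1 * g 0 + (Σ< (suc a) (λ i → binom a (suc i) * g (suc i)) + Σ< (suc a) (λ i → binom a i * g (suc i)))
      ≡⟨ cong (1 * g 0 +_) (Σ<-pascal a (suc a) g) ⟩
    Σ< (suc (suc a)) (λ i → binom (suc a) i * g i) ∎
    where
    a = length xs
    G = λ p → g (length (proj₂ p))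
    lastTerm : Σ< (suc a) (λ i → binom a (suc i) * g (suc i)) ≡ Σ< a (λ i → binom a (suc i) * g (suc i))
    lastTerm = trans (Σ<-last a _) (trans (cong (Σ< a (λ i → binom a (suc i) * g (suc i)) +_)
                                              (cong (_* g (suc a)) (binom-vanish a (suc a) (n<1+n a))))
                                        (+-identityʳ _))

  Σ∈-splits⁺ : ∀ xs (g : ℕ → ℕ) →
    Σ∈ (splits⁺ xs) (λ p → g (length (proj₂ p))) ≡ Σ< (length xs) (λ i → binom (length xs) i * g i)
  Σ∈-splits⁺ []       g = refl
  Σ∈-splits⁺ (x ∷ xs) g = begin
    Σ∈ (map (map₁ (x ∷_)) (splits xs) ++ map (map₂ (x ∷_)) (splits⁺ xs)) G
      ≡⟨ Σ∈-++ (map (map₁ (x ∷_)) (splits xs)) (map (map₂ (x ∷_)) (splits⁺ xs)) G ⟩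
    Σ∈ (map (map₁ (x ∷_)) (splits xs)) G + Σ∈ (map (map₂ (x ∷_)) (splits⁺ xs)) G
      ≡⟨ cong₂ _+_ (Σ∈-map (map₁ (x ∷_)) (splits xs) G) (Σ∈-map (map₂ (x ∷_)) (splits⁺ xs) G) ⟩
    Σ∈ (splits xs) G + Σ∈ (splits⁺ xs) (λ p → g (suc (length (proj₂ p))))
      ≡⟨ cong₂ _+_ (Σ∈-splits xs g) (Σ∈-splits⁺ xs (λ i → g (suc i))) ⟩
    (1 * g 0 + Σ< a (λ i → binom a (suc i) * g (suc i))) + Σ< a (λ i → binom a i * g (suc i))
      ≡⟨ +-assoc (1 * g 0) _ _ ⟩
    1 * g 0 + (Σ< a (λ i → binom a (suc i) * g (suc i)) + Σ< a (λ i → binom a i * g (suc i)))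
      ≡⟨ cong (1 * g 0 +_) (Σ<-pascal a a g) ⟩
    Σ< (suc a) (λ i → binom (suc a) i * g i) ∎
    where
    a = length xs
    G = λ p → g (length (proj₂ p))

  fuel-decreases : ∀ {A s r : List ℕ} (B : List ℕ) f → Interleaving s r A → NonEmpty s →
    length A + length B ≤ suc f → length r + length B ≤ f
  fuel-decreases {A} {x ∷ s} {r} B f sp _ le = ≤-pred (≤-trans (+-monoˡ-≤ (length B) r<A) le)
    where
    r<A : suc (length r) ≤ length A
    r<A = subst (suc (length r) ≤_) (sym (interleave-length sp)) (s≤s (m≤n+m (length r) (length s)))

  altCount-0-0 : altCount 0 0 ≡ 1
  altCount-0-0 = cong (λ z → z * (z + 0) + 0) surj-0-0

  altCount-0-suc : ∀ b → altCount 0 (suc b) ≡ 0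
  altCount-0-suc b = cong₂ (λ u v → u * (v + 0) + 0) surj-0-0 (surj-suc-0 b)

  altCount-suc : ∀ a b → Σ< (suc a) (λ i → binom (suc a) i * altCount b i) ≡ altCount (suc a) b
  altCount-suc a b = begin
    Σ< (suc a) (λ i → binom (suc a) i * altCount b i)
      ≡⟨ altCount-firstRun (suc a) b ⟩
    Σ< (suc b) (λ r → surj b r * (surj (suc a) (suc r) + surjPos (suc a) r))
      ≡⟨ sym (+-identityʳ _) ⟩
    Σ< (suc b) (λ r → surj b r * (surj (suc a) (suc r) + surjPos (suc a) r)) + 0
      ≡⟨ cong (Σ< (suc b) (λ r → surj b r * (surj (suc a) (suc r) + surjPos (suc a) r)) +_) (sym (cong (_* surj b 0) (surj-suc-0 a))) ⟩
    Σ< (suc b) (λ r → surj b r * (surj (suc a) (suc r) + surjPos (suc a) r)) + surj (suc a) 0 * surj b 0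
      ≡⟨ altCount-byLargeRuns (suc a) b ⟩
    altCount (suc a) b ∎

  mutual
    length-loWords⁺ : ∀ f A B → length A + length B ≤ suc f →
      length (loWords⁺ (suc f) A B) ≡ Σ< (length A) (λ i → binom (length A) i * altCount (length B) i)
    length-loWords⁺ f A B le = begin
      length (loWords⁺ (suc f) A B)
        ≡⟨ length-concatMap (λ p → map (proj₁ p ++_) (hiWords f (proj₂ p) B)) (splits⁺ A) ⟩
      Σ∈ (splits⁺ A) (λ p → length (map (proj₁ p ++_) (hiWords f (proj₂ p) B)))
        ≡⟨ Σ∈-congAll (All.tabulate λ {p} m → let (sp , ne) = splits⁺-sound A m in
              trans (length-map (proj₁ p ++_) (hiWords f (proj₂ p) B)) (length-hiWords f (proj₂ p) B (fuel-decreases B f sp ne le))) ⟩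
      Σ∈ (splits⁺ A) (λ p → altCount (length B) (length (proj₂ p)))
        ≡⟨ Σ∈-splits⁺ A (altCount (length B)) ⟩
      Σ< (length A) (λ i → binom (length A) i * altCount (length B) i) ∎

    length-hiWords⁺ : ∀ f A B → length A + length B ≤ suc f →
      length (hiWords⁺ (suc f) A B) ≡ Σ< (length B) (λ i → binom (length B) i * altCount (length A) i)
    length-hiWords⁺ f A B le = begin
      length (hiWords⁺ (suc f) A B)
        ≡⟨ length-concatMap (λ p → map (proj₁ p ++_) (loWords f A (proj₂ p))) (splits⁺ B) ⟩
      Σ∈ (splits⁺ B) (λ p → length (map (proj₁ p ++_) (loWords f A (proj₂ p))))
        ≡⟨ Σ∈-congAll (All.tabulate λ {p} m → let (sp , ne) = splits⁺-sound B m in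
              trans (length-map (proj₁ p ++_) (loWords f A (proj₂ p))) (length-loWords f A (proj₂ p) (le′ sp ne))) ⟩
      Σ∈ (splits⁺ B) (λ p → altCount (length A) (length (proj₂ p)))
        ≡⟨ Σ∈-splits⁺ B (altCount (length A)) ⟩
      Σ< (length B) (λ i → binom (length B) i * altCount (length A) i) ∎
      where
      le′ : ∀ {s r} → Interleaving s r B → NonEmpty s → length A + length r ≤ f
      le′ {s} {r} sp ne = subst (_≤ f) (+-comm (length r) (length A))
                            (fuel-decreases A f sp ne (subst (_≤ suc f) (+-comm (length A) (length B)) le))

    length-loWords : ∀ f A B → length A + length B ≤ f → length (loWords f A B) ≡ altCount (length A) (length B)
    length-loWords f       []      []      _  = sym altCount-0-0
    length-loWords f       []      (b ∷ B) _  = sym (altCount-0-suc (length B))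
    length-loWords zero    (a ∷ A) B       ()
    length-loWords (suc f) (a ∷ A) B       le = trans (length-loWords⁺ f (a ∷ A) B le) (altCount-suc (length A) (length B))

    length-hiWords : ∀ f A B → length A + length B ≤ f → length (hiWords f A B) ≡ altCount (length B) (length A)
    length-hiWords f       []      []      _  = sym altCount-0-0
    length-hiWords zero    []      (b ∷ B) ()
    length-hiWords zero    (a ∷ A) (b ∷ B) ()
    length-hiWords (suc f) []      (b ∷ B) le = trans (length-hiWords⁺ f [] (b ∷ B) le) (altCount-suc (length B) 0)
    length-hiWords (suc f) (a ∷ A) (b ∷ B) le = trans (length-hiWords⁺ f (a ∷ A) (b ∷ B) le) (altCount-suc (length B) (length (a ∷ A)))
    length-hiWords f       (a ∷ A) []      _  = sym (altCount-0-suc (length A))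

module RunWordsCorrect (t : ℕ) where

  open import Data.Nat as ℕ using (ℕ; zero; suc; _+_; _≤_; _<_; _≤?_)
  open import Data.Nat.Properties using (≰⇒>; <-trans; <-irrefl; ≤-<-trans; +-comm)
  open import Data.Empty using (⊥; ⊥-elim)
  open import Data.Unit using (⊤; tt)
  open import Data.Sum using (_⊎_; inj₁; inj₂)
  open import Data.Product using (_×_; _,_; proj₁; proj₂; ∃₂; map₁; map₂)
  open import Data.List using (List; []; _∷_; _++_; map; concatMap; length)
  open import Data.List.Properties using (++-assoc; ++-cancelˡ; ∷-injective)
  open import Data.List.Relation.Unary.All as All using (All; []; _∷_)
  open import Data.List.Relation.Unary.AllPairs using (AllPairs; []; _∷_)
  open import Data.List.Relation.Unary.Linked as Linked using (Linked; []; [-]; _∷_)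
  open import Data.List.Relation.Unary.Linked.Properties using (Linked⇒AllPairs)
  open import Data.List.Relation.Unary.Any using (here; there)
  open import Data.List.Relation.Unary.Unique.Propositional using (Unique)
  import Data.List.Relation.Unary.Unique.Propositional.Properties as Unique
  open import Data.List.Relation.Binary.Disjoint.Propositional using (Disjoint)
  open import Data.List.Membership.Propositional using (_∈_)
  open import Data.List.Membership.Propositional.Properties using (∈-map⁺; ∈-map⁻; ∈-++⁺ˡ; ∈-++⁻; ∈-concat⁺′; ∈-concat⁻′)
  open import Data.List.Relation.Binary.Permutation.Propositional using (_↭_; ↭-sym; ↭-trans; ↭-refl; ↭-reflexive)
  open import Data.List.Relation.Binary.Permutation.Propositional.Properties using (shifts; ++⁺ˡ; ++⁺ʳ; drop-∷; ∈-resp-↭; ↭-empty-inv)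
  open import Data.List.Relation.Ternary.Interleaving.Propositional using (Interleaving; toPermutation)
  open import Function using (_∘_)
  open import Relation.Binary.PropositionalEquality
  open import Relation.Nullary using (yes; no)
  open Splits
  open RunWords

  Lo Hi : ℕ → Set
  Lo x = x ≤ t
  Hi x = t < x

  lo-hi-disjoint : ∀ {x} → Lo x → Hi x → ⊥
  lo-hi-disjoint lo hi = <-irrefl refl (≤-<-trans lo hi)

  -- Adjacent letters of a Callan word: an ascent, or a descent from a large to a small letter.
  Step : ℕ → ℕ → Set
  Step x y = x < y ⊎ (y ≤ t × t < x)

  StartsWith : (ℕ → Set) → List ℕ → Set
  StartsWith Q [] = ⊤
  StartsWith Q (x ∷ _) = Q x

  Letters : List ℕ → List ℕ → Set
  Letters A B = AllPairs _<_ A × AllPairs _<_ B × All Lo A × All Hi B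

  run-lo-++ : ∀ s w → NonEmpty s → AllPairs _<_ s → All Lo s → StartsWith Hi w → Linked Step w → Linked Step (s ++ w)
  run-lo-++ (x ∷ []) [] _ _ _ _ _ = [-]
  run-lo-++ (x ∷ []) (y ∷ w) _ _ (lx ∷ []) hy lw = inj₁ (≤-<-trans lx hy) ∷ lw
  run-lo-++ (x ∷ x' ∷ s) w _ ((px' ∷ _) ∷ ps) (_ ∷ ls) hw lw = inj₁ px' ∷ run-lo-++ (x' ∷ s) w tt ps ls hw lw

  run-hi-++ : ∀ s w → NonEmpty s → AllPairs _<_ s → All Hi s → StartsWith Lo w → Linked Step w → Linked Step (s ++ w)
  run-hi-++ (x ∷ []) [] _ _ _ _ _ = [-]
  run-hi-++ (x ∷ []) (y ∷ w) _ _ (hx ∷ []) ly lw = inj₂ (ly , hx) ∷ lw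
  run-hi-++ (x ∷ x' ∷ s) w _ ((px' ∷ _) ∷ ps) (_ ∷ hs) lw' lw = inj₁ px' ∷ run-hi-++ (x' ∷ s) w tt ps hs lw' lw

  startsWith-++ : ∀ {Q : ℕ → Set} s w → NonEmpty s → All Q s → StartsWith Q (s ++ w)
  startsWith-++ (x ∷ s) w _ (q ∷ _) = q

  ∈-prefixed⁻ : ∀ {X : Set} (G : X → List (List ℕ)) (pre : X → List ℕ) xs {w} →
    w ∈ concatMap (λ p → map (pre p ++_) (G p)) xs → ∃₂ λ p w' → p ∈ xs × w' ∈ G p × w ≡ pre p ++ w'
  ∈-prefixed⁻ G pre xs {w} m with ∈-concat⁻′ (map (λ p → map (pre p ++_) (G p)) xs) m
  ... | ys , w∈ys , ys∈ with ∈-map⁻ (λ p → map (pre p ++_) (G p)) ys∈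
  ...   | p , p∈ , refl with ∈-map⁻ (pre p ++_) w∈ys
  ...     | w' , w'∈ , refl = p , w' , p∈ , w'∈ , refl

  ∈-prefixed⁺ : ∀ {X : Set} (G : X → List (List ℕ)) (pre : X → List ℕ) xs {p w'} →
    p ∈ xs → w' ∈ G p → pre p ++ w' ∈ concatMap (λ p → map (pre p ++_) (G p)) xs
  ∈-prefixed⁺ G pre xs p∈ w'∈ = ∈-concat⁺′ (∈-map⁺ (pre _ ++_) w'∈) (∈-map⁺ (λ p → map (pre p ++_) (G p)) p∈)

  Sound : (List ℕ → Set) → List ℕ → List ℕ → List ℕ → Set
  Sound HdQ A B w = Linked Step w × HdQ w × (w ↭ A ++ B)

  mutual
    loWords⁺-sound : ∀ f A B w → w ∈ loWords⁺ f A B → Letters A B → Sound (StartsWith Lo) A B w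
    loWords⁺-sound zero A B w ()
    loWords⁺-sound (suc f) A B w m (iA , iB , lA , hB) with ∈-prefixed⁻ (λ p → hiWords f (proj₂ p) B) proj₁ (splits⁺ A) m
    ... | (s , r) , w' , p∈ , w'∈ , refl =
          let (sp , ne) = splits⁺-sound A p∈
              (ss , sr) = sorted-interleaving⁻ iA sp
              (ls , lr) = All-interleaving⁻ lA sp
              (lw , hw , pw) = hiWords-sound f r B w' w'∈ (sr , iB , lr , hB)
          in run-lo-++ s w' ne ss ls hw lw , startsWith-++ s w' ne ls ,
             ↭-trans (++⁺ˡ s pw) (↭-trans (↭-reflexive (sym (++-assoc s r B))) (++⁺ʳ B (↭-sym (toPermutation sp))))

    hiWords⁺-sound : ∀ f A B w → w ∈ hiWords⁺ f A B → Letters A B → Sound (StartsWith Hi) A B w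
    hiWords⁺-sound zero A B w ()
    hiWords⁺-sound (suc f) A B w m (iA , iB , lA , hB) with ∈-prefixed⁻ (λ p → loWords f A (proj₂ p)) proj₁ (splits⁺ B) m
    ... | (s , r) , w' , p∈ , w'∈ , refl =
          let (sp , ne) = splits⁺-sound B p∈
              (ss , sr) = sorted-interleaving⁻ iB sp
              (hs , hr) = All-interleaving⁻ hB sp
              (lw , hw , pw) = loWords-sound f A r w' w'∈ (iA , sr , lA , hr)
          in run-hi-++ s w' ne ss hs hw lw , startsWith-++ s w' ne hs ,
             ↭-trans (++⁺ˡ s pw) (↭-trans (shifts s A) (++⁺ˡ A (↭-sym (toPermutation sp))))

    loWords-sound : ∀ f A B w → w ∈ loWords f A B → Letters A B → Sound (StartsWith Lo) A B w
    loWords-sound f [] [] w (here refl) _ = [] , tt , ↭-refl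
    loWords-sound f [] (b ∷ B) w () inv
    loWords-sound f (a ∷ A) B w m inv = loWords⁺-sound f (a ∷ A) B w m inv

    hiWords-sound : ∀ f A B w → w ∈ hiWords f A B → Letters A B → Sound (StartsWith Hi) A B w
    hiWords-sound f [] [] w (here refl) _ = [] , tt , ↭-refl
    hiWords-sound f [] (b ∷ B) w m inv = hiWords⁺-sound f [] (b ∷ B) w m inv
    hiWords-sound f (a ∷ A) (b ∷ B) w m inv = hiWords⁺-sound f (a ∷ A) (b ∷ B) w m inv
    hiWords-sound f (a ∷ A) [] w () inv

  spanLo : ∀ w → ∃₂ λ s w' → w ≡ s ++ w' × All Lo s × StartsWith Hi w'
  spanLo [] = [] , [] , refl , [] , tt
  spanLo (x ∷ w) with x ≤? t
  ... | yes lx = let (s , w' , eq , ls , hw) = spanLo w in x ∷ s , w' , cong (x ∷_) eq , lx ∷ ls , hw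
  ... | no nx = [] , x ∷ w , refl , [] , ≰⇒> nx

  spanHi : ∀ w → ∃₂ λ s w' → w ≡ s ++ w' × All Hi s × StartsWith Lo w'
  spanHi [] = [] , [] , refl , [] , tt
  spanHi (x ∷ w) with x ≤? t
  ... | yes lx = [] , x ∷ w , refl , [] , lx
  ... | no nx = let (s , w' , eq , hs , lw) = spanHi w in x ∷ s , w' , cong (x ∷_) eq , ≰⇒> nx ∷ hs , lw

  spanLo⁺ : ∀ x w → Lo x → ∃₂ λ s w' → x ∷ w ≡ s ++ w' × NonEmpty s × All Lo s × StartsWith Hi w'
  spanLo⁺ x w lx = let (s , w' , eq , ls , hw) = spanLo w in x ∷ s , w' , cong (x ∷_) eq , tt , lx ∷ ls , hw

  spanHi⁺ : ∀ x w → Hi x → ∃₂ λ s w' → x ∷ w ≡ s ++ w' × NonEmpty s × All Hi s × StartsWith Lo w'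
  spanHi⁺ x w hx = let (s , w' , eq , hs , lw) = spanHi w in x ∷ s , w' , cong (x ∷_) eq , tt , hx ∷ hs , lw

  linked-++⁻ : ∀ s w → Linked Step (s ++ w) → Linked Step s × Linked Step w
  linked-++⁻ [] w l = [] , l
  linked-++⁻ (x ∷ []) w l = [-] , Linked.tail l
  linked-++⁻ (x ∷ y ∷ s) w (r ∷ l) = let (a , b) = linked-++⁻ (y ∷ s) w l in r ∷ a , b

  run-lo-increasing : ∀ {s} → All Lo s → Linked Step s → Linked _<_ s
  run-lo-increasing _ [] = []
  run-lo-increasing _ [-] = [-]
  run-lo-increasing (lx ∷ ls) (inj₁ lt ∷ l) = lt ∷ run-lo-increasing ls l
  run-lo-increasing (lx ∷ ls) (inj₂ (_ , hx) ∷ l) = ⊥-elim (lo-hi-disjoint lx hx)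

  run-hi-increasing : ∀ {s} → All Hi s → Linked Step s → Linked _<_ s
  run-hi-increasing _ [] = []
  run-hi-increasing _ [-] = [-]
  run-hi-increasing (hx ∷ hs) (inj₁ lt ∷ l) = lt ∷ run-hi-increasing hs l
  run-hi-increasing (hx ∷ hy ∷ hs) (inj₂ (ly , _) ∷ l) = ⊥-elim (lo-hi-disjoint ly hy)

  ↭-cancelˡ : ∀ s {xs ys : List ℕ} → s ++ xs ↭ s ++ ys → xs ↭ ys
  ↭-cancelˡ [] p = p
  ↭-cancelˡ (x ∷ s) p = ↭-cancelˡ s (drop-∷ p)

  prefix⊆left : ∀ {P Q : ℕ → Set} → (∀ {z} → P z → Q z → ⊥) → ∀ {s w' A B} → All P s → All Q B → s ++ w' ↭ A ++ B → All (_∈ A) s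
  prefix⊆left {P} {Q} dis {s} {w'} {A} {B} ps qB p = All.tabulate f
    where
    f : ∀ {z} → z ∈ s → z ∈ A
    f {z} m with ∈-++⁻ A (∈-resp-↭ p (∈-++⁺ˡ m))
    ... | inj₁ mA = mA
    ... | inj₂ mB = ⊥-elim (dis (All.lookup ps m) (All.lookup qB mB))

  prefix⊆right : ∀ {P Q : ℕ → Set} → (∀ {z} → P z → Q z → ⊥) → ∀ {s w' A B} → All P s → All Q A → s ++ w' ↭ A ++ B → All (_∈ B) s
  prefix⊆right {P} {Q} dis {s} {w'} {A} {B} ps qA p = All.tabulate f
    where
    f : ∀ {z} → z ∈ s → z ∈ B
    f {z} m with ∈-++⁻ A (∈-resp-↭ p (∈-++⁺ˡ m))
    ... | inj₁ mA = ⊥-elim (dis (All.lookup ps m) (All.lookup qA mA))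
    ... | inj₂ mB = mB

  -- The maximal initial run of small letters is a sorted subsequence of A, hence appears
  -- in splits⁺ A, and the rest of the word is a smaller instance with the roles swapped.
  mutual
    loWords-complete : ∀ f A B w → Linked Step w → StartsWith Lo w → w ↭ A ++ B → Letters A B → length A + length B ≤ f → w ∈ loWords f A B
    loWords-complete f [] [] [] lw hw pw inv le = here refl
    loWords-complete f [] (b ∷ B) [] lw hw pw inv le with ↭-empty-inv (↭-sym pw)
    ... | ()
    loWords-complete f (a ∷ A) B [] lw hw pw inv le with ↭-empty-inv (↭-sym pw)
    ... | ()
    loWords-complete f [] B (x ∷ w₀) lw hw pw (iA , iB , lA , hB) le = ⊥-elim (lo-hi-disjoint hw (All.lookup hB (∈-resp-↭ pw (here refl))))
    loWords-complete zero (a ∷ A) B (x ∷ w₀) lw hw pw inv ()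
    loWords-complete (suc f) (a ∷ A) B (x ∷ w₀) lw hw pw (iA , iB , lA , hB) le with spanLo⁺ x w₀ hw
    ... | s , w' , eq , ne , ls , hw' =
      subst (_∈ loWords⁺ (suc f) (a ∷ A) B) (sym eq)
        (∈-prefixed⁺ (λ p → hiWords f (proj₂ p) B) proj₁ (splits⁺ (a ∷ A)) (splits⁺-complete sp ne)
          (hiWords-complete f r B w' lW hw' pw'' (proj₂ (sorted-interleaving⁻ iA sp) , iB , proj₂ (All-interleaving⁻ lA sp) , hB) (fuel-decreases B f sp ne le)))
      where
      AA = a ∷ A
      lw' = subst (Linked Step) eq lw
      lS = proj₁ (linked-++⁻ s w' lw')
      lW = proj₂ (linked-++⁻ s w' lw')
      sortedS = Linked⇒AllPairs <-trans (run-lo-increasing ls lS)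
      pw' : s ++ w' ↭ AA ++ B
      pw' = subst (_↭ AA ++ B) eq pw
      inA = prefix⊆left lo-hi-disjoint ls hB pw'
      r = proj₁ (interleaving-exists iA sortedS inA)
      sp = proj₂ (interleaving-exists iA sortedS inA)
      pw'' : w' ↭ r ++ B
      pw'' = ↭-cancelˡ s (↭-trans pw' (↭-trans (++⁺ʳ B (toPermutation sp)) (↭-reflexive (++-assoc s r B))))

    hiWords-complete : ∀ f A B w → Linked Step w → StartsWith Hi w → w ↭ A ++ B → Letters A B → length A + length B ≤ f → w ∈ hiWords f A B
    hiWords-complete f [] [] [] lw hw pw inv le = here refl
    hiWords-complete f [] (b ∷ B) [] lw hw pw inv le with ↭-empty-inv (↭-sym pw)
    ... | ()
    hiWords-complete f (a ∷ A) B [] lw hw pw inv le with ↭-empty-inv (↭-sym pw)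
    ... | ()
    hiWords-complete f A [] (x ∷ w₀) lw hw pw (iA , iB , lA , hB) le with ∈-++⁻ A (∈-resp-↭ pw (here refl))
    ... | inj₁ mA = ⊥-elim (lo-hi-disjoint (All.lookup lA mA) hw)
    ... | inj₂ ()
    hiWords-complete zero [] (b ∷ B) (x ∷ w₀) lw hw pw inv ()
    hiWords-complete zero (a ∷ A) (b ∷ B) (x ∷ w₀) lw hw pw inv ()
    hiWords-complete (suc f) [] (b ∷ B) (x ∷ w₀) lw hw pw inv le = hiWords⁺-complete f [] B b x w₀ lw hw pw inv le
    hiWords-complete (suc f) (a ∷ A) (b ∷ B) (x ∷ w₀) lw hw pw inv le = hiWords⁺-complete f (a ∷ A) B b x w₀ lw hw pw inv le

    hiWords⁺-complete : ∀ f A B b x w₀ → Linked Step (x ∷ w₀) → Hi x → x ∷ w₀ ↭ A ++ b ∷ B → Letters A (b ∷ B) → length A + length (b ∷ B) ≤ suc f →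
      x ∷ w₀ ∈ hiWords⁺ (suc f) A (b ∷ B)
    hiWords⁺-complete f A B b x w₀ lw hw pw (iA , iB , lA , hB) le with spanHi⁺ x w₀ hw
    ... | s , w' , eq , ne , hs , lw₁ =
      subst (_∈ hiWords⁺ (suc f) A BB) (sym eq)
        (∈-prefixed⁺ (λ p → loWords f A (proj₂ p)) proj₁ (splits⁺ BB) (splits⁺-complete sp ne)
          (loWords-complete f A r w' lW lw₁ pw'' (iA , proj₂ (sorted-interleaving⁻ iB sp) , lA , proj₂ (All-interleaving⁻ hB sp)) le'))
      where
      BB = b ∷ B
      lw' = subst (Linked Step) eq lw
      lS = proj₁ (linked-++⁻ s w' lw')
      lW = proj₂ (linked-++⁻ s w' lw')
      sortedS = Linked⇒AllPairs <-trans (run-hi-increasing hs lS)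
      pw' : s ++ w' ↭ A ++ BB
      pw' = subst (_↭ A ++ BB) eq pw
      inB = prefix⊆right (λ h l → lo-hi-disjoint l h) hs lA pw'
      r = proj₁ (interleaving-exists iB sortedS inB)
      sp = proj₂ (interleaving-exists iB sortedS inB)
      pw'' : w' ↭ A ++ r
      pw'' = ↭-cancelˡ s (↭-trans pw' (↭-trans (++⁺ˡ A (toPermutation sp)) (shifts A s)))
      le' : length A + length r ≤ f
      le' = subst (_≤ f) (+-comm (length r) (length A)) (fuel-decreases A f sp ne (subst (_≤ suc f) (+-comm (length A) (length BB)) le))

  Unique-concatMap : ∀ {X Y : Set} (g : X → List Y) (xs : List X) → Unique xs → (∀ {p} → p ∈ xs → Unique (g p)) →
    (∀ {p q w} → p ∈ xs → q ∈ xs → w ∈ g p → w ∈ g q → p ≡ q) → Unique (concatMap g xs)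
  Unique-concatMap g [] _ _ _ = []
  Unique-concatMap g (x ∷ xs) (ax ∷ uxs) ug dj = Unique.++⁺ (ug (here refl)) (Unique-concatMap g xs uxs (ug ∘ there) (λ a b → dj (there a) (there b))) disj
    where
    disj : Disjoint (g x) (concatMap g xs)
    disj (w∈gx , w∈c) with ∈-concat⁻′ (map g xs) w∈c
    ... | ys , w∈ys , ys∈ with ∈-map⁻ g ys∈
    ...   | q , q∈ , refl = All.lookup ax q∈ (dj (here refl) (there q∈) w∈gx w∈ys)

  map₁-∷-injective : ∀ {x} {p q : List ℕ × List ℕ} → map₁ (x ∷_) p ≡ map₁ (x ∷_) q → p ≡ q
  map₁-∷-injective {p = a , b} {q = c , d} refl = refl

  map₂-∷-injective : ∀ {x} {p q : List ℕ × List ℕ} → map₂ (x ∷_) p ≡ map₂ (x ∷_) q → p ≡ q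
  map₂-∷-injective {p = a , b} {q = c , d} refl = refl

  map₁-map₂-disjoint : ∀ {x xs} → All (x <_) xs → ∀ (L1 L2 : List (List ℕ × List ℕ)) → (∀ {q} → q ∈ L2 → Interleaving (proj₁ q) (proj₂ q) xs) →
    Disjoint (map (map₁ (x ∷_)) L1) (map (map₂ (x ∷_)) L2)
  map₁-map₂-disjoint {x} px L1 L2 sp2 (m1 , m2) with ∈-map⁻ (map₁ (x ∷_)) m1 | ∈-map⁻ (map₂ (x ∷_)) m2
  ... | p , _ , refl | q , q∈ , eq with proj₁ (All-interleaving⁻ px (sp2 q∈)) | cong proj₁ eq
  ...   | ax | e = bad ax e
    where
    bad : ∀ {s s'} → All (x <_) s' → x ∷ s ≡ s' → ⊥
    bad (lt ∷ _) refl = <-irrefl refl lt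

  splits-unique : ∀ A → AllPairs _<_ A → Unique (splits A)
  splits-unique [] _ = [] ∷ []
  splits-unique (x ∷ A) (px ∷ pA) = Unique.++⁺ (Unique.map⁺ map₁-∷-injective (splits-unique A pA)) (Unique.map⁺ map₂-∷-injective (splits-unique A pA))
    (map₁-map₂-disjoint px (splits A) (splits A) (splits-sound A))

  splits⁺-unique : ∀ A → AllPairs _<_ A → Unique (splits⁺ A)
  splits⁺-unique [] _ = []
  splits⁺-unique (x ∷ A) (px ∷ pA) = Unique.++⁺ (Unique.map⁺ map₁-∷-injective (splits-unique A pA)) (Unique.map⁺ map₂-∷-injective (splits⁺-unique A pA))
    (map₁-map₂-disjoint px (splits A) (splits⁺ A) (λ m → proj₁ (splits⁺-sound A m)))

  run-prefix-unique : ∀ {P Q : ℕ → Set} → (∀ {z} → P z → Q z → ⊥) → ∀ s s' w₁ w₂ →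
    All P s → All P s' → StartsWith Q w₁ → StartsWith Q w₂ → s ++ w₁ ≡ s' ++ w₂ → s ≡ s'
  run-prefix-unique dis [] [] w₁ w₂ _ _ _ _ _ = refl
  run-prefix-unique dis [] (y ∷ s') w₁ w₂ _ (py ∷ _) hq _ refl = ⊥-elim (dis py hq)
  run-prefix-unique dis (x ∷ s) [] w₁ w₂ (px ∷ _) _ _ hq refl = ⊥-elim (dis px hq)
  run-prefix-unique dis (x ∷ s) (y ∷ s') w₁ w₂ (_ ∷ ps) (_ ∷ ps') h1 h2 eq =
    cong₂ _∷_ (proj₁ (∷-injective eq)) (run-prefix-unique dis s s' w₁ w₂ ps ps' h1 h2 (proj₂ (∷-injective eq)))

  mutual
    loWords⁺-unique : ∀ f A B → Letters A B → Unique (loWords⁺ f A B)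
    loWords⁺-unique zero A B _ = []
    loWords⁺-unique (suc f) A B (iA , iB , lA , hB) = Unique-concatMap (λ p → map (proj₁ p ++_) (hiWords f (proj₂ p) B)) (splits⁺ A) (splits⁺-unique A iA) ug dj
      where
      letters-rest : ∀ {p} → p ∈ splits⁺ A → Letters (proj₂ p) B
      letters-rest m = let sp = proj₁ (splits⁺-sound A m) in proj₂ (sorted-interleaving⁻ iA sp) , iB , proj₂ (All-interleaving⁻ lA sp) , hB
      ug : ∀ {p} → p ∈ splits⁺ A → Unique (map (proj₁ p ++_) (hiWords f (proj₂ p) B))
      ug {p} m = Unique.map⁺ (λ {x} {y} → ++-cancelˡ (proj₁ p) x y) (hiWords-unique f (proj₂ p) B (letters-rest m))
      dj : ∀ {p q w} → p ∈ splits⁺ A → q ∈ splits⁺ A → w ∈ map (proj₁ p ++_) (hiWords f (proj₂ p) B) → w ∈ map (proj₁ q ++_) (hiWords f (proj₂ q) B) → p ≡ q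
      dj {s , r} {s' , r'} mp mq wp wq with ∈-map⁻ (s ++_) wp | ∈-map⁻ (s' ++_) wq
      ... | w₁ , w₁∈ , refl | w₂ , w₂∈ , eq = cong₂ _,_ s≡ (interleaving-complement iA sp (subst (λ z → Interleaving z r' A) (sym s≡) sp'))
        where
        sp = proj₁ (splits⁺-sound A mp)
        sp' = proj₁ (splits⁺-sound A mq)
        s≡ : s ≡ s'
        s≡ = run-prefix-unique lo-hi-disjoint s s' w₁ w₂ (proj₁ (All-interleaving⁻ lA sp)) (proj₁ (All-interleaving⁻ lA sp'))
               (proj₁ (proj₂ (hiWords-sound f r B w₁ w₁∈ (letters-rest mp)))) (proj₁ (proj₂ (hiWords-sound f r' B w₂ w₂∈ (letters-rest mq)))) eq

    hiWords⁺-unique : ∀ f A B → Letters A B → Unique (hiWords⁺ f A B)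
    hiWords⁺-unique zero A B _ = []
    hiWords⁺-unique (suc f) A B (iA , iB , lA , hB) = Unique-concatMap (λ p → map (proj₁ p ++_) (loWords f A (proj₂ p))) (splits⁺ B) (splits⁺-unique B iB) ug dj
      where
      letters-rest : ∀ {p} → p ∈ splits⁺ B → Letters A (proj₂ p)
      letters-rest m = let sp = proj₁ (splits⁺-sound B m) in iA , proj₂ (sorted-interleaving⁻ iB sp) , lA , proj₂ (All-interleaving⁻ hB sp)
      ug : ∀ {p} → p ∈ splits⁺ B → Unique (map (proj₁ p ++_) (loWords f A (proj₂ p)))
      ug {p} m = Unique.map⁺ (λ {x} {y} → ++-cancelˡ (proj₁ p) x y) (loWords-unique f A (proj₂ p) (letters-rest m))
      dj : ∀ {p q w} → p ∈ splits⁺ B → q ∈ splits⁺ B → w ∈ map (proj₁ p ++_) (loWords f A (proj₂ p)) → w ∈ map (proj₁ q ++_) (loWords f A (proj₂ q)) → p ≡ q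
      dj {s , r} {s' , r'} mp mq wp wq with ∈-map⁻ (s ++_) wp | ∈-map⁻ (s' ++_) wq
      ... | w₁ , w₁∈ , refl | w₂ , w₂∈ , eq = cong₂ _,_ s≡ (interleaving-complement iB sp (subst (λ z → Interleaving z r' B) (sym s≡) sp'))
        where
        sp = proj₁ (splits⁺-sound B mp)
        sp' = proj₁ (splits⁺-sound B mq)
        s≡ : s ≡ s'
        s≡ = run-prefix-unique (λ h l → lo-hi-disjoint l h) s s' w₁ w₂ (proj₁ (All-interleaving⁻ hB sp)) (proj₁ (All-interleaving⁻ hB sp'))
               (proj₁ (proj₂ (loWords-sound f A r w₁ w₁∈ (letters-rest mp)))) (proj₁ (proj₂ (loWords-sound f A r' w₂ w₂∈ (letters-rest mq)))) eq

    loWords-unique : ∀ f A B → Letters A B → Unique (loWords f A B)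
    loWords-unique f [] [] _ = [] ∷ []
    loWords-unique f [] (b ∷ B) inv = []
    loWords-unique f (a ∷ A) B inv = loWords⁺-unique f (a ∷ A) B inv

    hiWords-unique : ∀ f A B → Letters A B → Unique (hiWords f A B)
    hiWords-unique f [] [] _ = [] ∷ []
    hiWords-unique f [] (b ∷ B) inv = hiWords⁺-unique f [] (b ∷ B) inv
    hiWords-unique f (a ∷ A) (b ∷ B) inv = hiWords⁺-unique f (a ∷ A) (b ∷ B) inv
    hiWords-unique f (a ∷ A) [] inv = []


module CallanWords (n k : ℕ) where

  open import Data.Nat as ℕ using (zero; suc; _+_; _<_; s≤s; _≤?_)
  open import Data.Nat.Properties using (≤-refl; m≤m+n; ≤-<-trans; ≰⇒>; +-monoʳ-<; <-irrefl; m+n≡0⇒m≡0)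
  open import Data.Unit using (tt)
  open import Data.Sum using (_⊎_; inj₁; inj₂)
  open import Data.Product using (_×_; _,_; proj₂)
  open import Data.List using (List; []; _∷_; _++_; length; applyUpTo)
  open import Data.List.Properties using (length-++; length-applyUpTo)
  open import Data.List.Relation.Unary.All using (All; []; _∷_)
  import Data.List.Relation.Unary.All.Properties as All
  open import Data.List.Relation.Unary.AllPairs using (AllPairs; []; _∷_)
  open import Data.List.Relation.Unary.Linked as Linked using (Linked; []; [-]; _∷_)
  open import Data.List.Relation.Unary.Unique.Propositional using (Unique)
  import Data.List.Relation.Unary.Unique.Propositional.Properties as Unique
  open import Data.List.Membership.Propositional using (_∈_)
  open import Data.List.Membership.Propositional.Properties using (∈-++⁺ˡ; ∈-++⁺ʳ; ∈-++⁻)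
  open import Data.List.Relation.Binary.Permutation.Propositional using (_↭_; ↭-sym)
  open import Data.List.Relation.Binary.Permutation.Propositional.Properties using (↭-empty-inv)
  open import Function using (_∘_; id; _⇔_; mk⇔)
  open import Relation.Binary.PropositionalEquality
  open import Relation.Nullary using (yes; no; ¬_)
  open AlternatingCounts using (altCount)
  open DescentsAndAscents using (applyUpTo-∘)
  open RunWords
  open RunWordsCorrect n

  small large : List ℕ
  small = applyUpTo suc n
  large = applyUpTo (λ i → suc (n + i)) k

  applyUpTo-+ : ∀ (f : ℕ → ℕ) a b → applyUpTo f (a + b) ≡ applyUpTo f a ++ applyUpTo (λ i → f (a + i)) b
  applyUpTo-+ f zero    b = refl
  applyUpTo-+ f (suc a) b = cong (f 0 ∷_) (applyUpTo-+ (f ∘ suc) a b)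

  range1≡small++large : range1 (n + k) ≡ small ++ large
  range1≡small++large = trans (sym (applyUpTo-∘ suc id (n + k))) (applyUpTo-+ suc n k)

  applyUpTo-sorted : ∀ (f : ℕ → ℕ) m → (∀ {i j} → i < j → f i < f j) → AllPairs _<_ (applyUpTo f m)
  applyUpTo-sorted f zero    mono = []
  applyUpTo-sorted f (suc m) mono =
    All.applyUpTo⁺₂ (f ∘ suc) m (λ i → mono (s≤s ℕ.z≤n)) ∷ applyUpTo-sorted (f ∘ suc) m (mono ∘ s≤s)

  letters : Letters small large
  letters = applyUpTo-sorted suc n s≤s
          , applyUpTo-sorted (λ i → suc (n + i)) k (s≤s ∘ +-monoʳ-< n)
          , All.applyUpTo⁺₁ suc n id
          , All.applyUpTo⁺₂ (λ i → suc (n + i)) k (λ i → s≤s (m≤m+n n i))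

  fuel : ℕ
  fuel = length small + length large

  callanWords : List (List ℕ)
  callanWords = loWords fuel small large ++ hiWords fuel small large

  CallanFactors : List ℕ → Set
  CallanFactors π = ∀ xs ys zs → π ≡ xs ++ ys ++ zs → (All Lo ys ⊎ All Hi ys) → Linked _<_ ys

  linked-step : ∀ π → CallanFactors π → Linked Step π
  linked-step []           _ = []
  linked-step (x ∷ [])     _ = [-]
  linked-step (x ∷ y ∷ ys) H = step ∷ linked-step (y ∷ ys) (λ xs ys′ zs eq → H (x ∷ xs) ys′ zs (cong (x ∷_) eq))
    where
    pair< : (All Lo (x ∷ y ∷ []) ⊎ All Hi (x ∷ y ∷ [])) → x < y
    pair< c = Linked.head (H [] (x ∷ y ∷ []) ys refl c)
    step : Step x y
    step with x ≤? n | y ≤? n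
    ... | yes lx | yes ly = inj₁ (pair< (inj₁ (lx ∷ ly ∷ [])))
    ... | yes lx | no ¬ly = inj₁ (≤-<-trans lx (≰⇒> ¬ly))
    ... | no ¬lx | yes ly = inj₂ (ly , ≰⇒> ¬lx)
    ... | no ¬lx | no ¬ly = inj₁ (pair< (inj₂ (≰⇒> ¬lx ∷ ≰⇒> ¬ly ∷ [])))

  callanFactors : ∀ π → Linked Step π → CallanFactors π
  callanFactors π lπ xs ys zs refl c with linked-++⁻ ys zs (proj₂ (linked-++⁻ xs (ys ++ zs) lπ))
  ... | lys , _ with c
  ...   | inj₁ los = run-lo-increasing los lys
  ...   | inj₂ his = run-hi-increasing his lys

  ∈callanWords⇔IsCallan : ∀ π → (π ∈ callanWords) ⇔ IsCallan n k π
  ∈callanWords⇔IsCallan π = mk⇔ to from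
    where
    isCallan : Linked Step π → π ↭ small ++ large → IsCallan n k π
    isCallan lπ p = subst (π ↭_) (sym range1≡small++large) p , callanFactors π lπ

    to : π ∈ callanWords → IsCallan n k π
    to m with ∈-++⁻ (loWords fuel small large) m
    ... | inj₁ m′ = let (lπ , _ , p) = loWords-sound fuel small large π m′ letters in isCallan lπ p
    ... | inj₂ m′ = let (lπ , _ , p) = hiWords-sound fuel small large π m′ letters in isCallan lπ p

    from : IsCallan n k π → π ∈ callanWords
    from (p , H) = by-first-letter π (subst (π ↭_) range1≡small++large p) (linked-step π H)
      where
      by-first-letter : ∀ π → π ↭ small ++ large → Linked Step π → π ∈ callanWords
      by-first-letter [] q lπ = ∈-++⁺ˡ (loWords-complete fuel small large [] lπ tt q letters ≤-refl)
      by-first-letter (x ∷ w) q lπ with x ≤? n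
      ... | yes lx = ∈-++⁺ˡ (loWords-complete fuel small large (x ∷ w) lπ lx q letters ≤-refl)
      ... | no ¬lx = ∈-++⁺ʳ (loWords fuel small large)
                       (hiWords-complete fuel small large (x ∷ w) lπ (≰⇒> ¬lx) q letters ≤-refl)

  length-small++large : length (small ++ large) ≡ n + k
  length-small++large = trans (length-++ small) (cong₂ _+_ (length-applyUpTo suc n) (length-applyUpTo _ k))

  []≁small++large : 0 < n → ¬ ([] ↭ small ++ large)
  []≁small++large 0<n p = <-irrefl refl (subst (0 <_) n≡0 0<n)
    where
    n≡0 : n ≡ 0
    n≡0 = m+n≡0⇒m≡0 n (trans (sym length-small++large) (cong length (↭-empty-inv (↭-sym p))))

  -- For n = 0 = k the empty word would be listed twice.
  callanWords-unique : 0 < n → Unique callanWords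
  callanWords-unique 0<n = Unique.++⁺ (loWords-unique fuel small large letters) (hiWords-unique fuel small large letters) disjoint
    where
    disjoint : ∀ {w} → ¬ (w ∈ loWords fuel small large × w ∈ hiWords fuel small large)
    disjoint {w} (m₁ , m₂) with loWords-sound fuel small large w m₁ letters | hiWords-sound fuel small large w m₂ letters
    disjoint {[]}    _ | (_ , _ , p) | _ = []≁small++large 0<n p
    disjoint {x ∷ w} _ | (_ , lo , _) | (_ , hi , _) = lo-hi-disjoint lo hi

  length-callanWords : length callanWords ≡ altCount n k + altCount k n
  length-callanWords = trans (length-++ (loWords fuel small large)) (cong₂ _+_
    (trans (length-loWords fuel small large ≤-refl) (cong₂ altCount (length-applyUpTo suc n) (length-applyUpTo _ k)))
    (trans (length-hiWords fuel small large ≤-refl) (cong₂ altCount (length-applyUpTo _ k) (length-applyUpTo suc n))))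

open import Data.Nat using (_>_; _+_; suc; s≤s; z≤n)
open import Data.Integer using (+_)
open import Data.List using (List; length)
open import Data.List.Relation.Unary.Unique.Propositional using (Unique)
open import Data.List.Membership.Propositional using (_∈_)
open import Data.Product using (_×_; Σ; _,_)
open import Function.Bundles using (_⇔_)
open import Relation.Binary.PropositionalEquality using (_≡_; sym; trans; cong)
open AlternatingCounts using (altCount; callanCount≡altCount+altCount)
open EulerianSum using (middleSum≡callanCount)
open PolyBernoulliNumbers using (polyBernoulli≡callanCount)

theorem5 : ∀ (n k : ℕ) → n > 0 → k > 0 →
    (Σ (List (List ℕ)) λ L →
        Unique L × (∀ π → (π ∈ L) ⇔ IsCallan n k π) × (length L ≡ middleSum n k))
    × (+ middleSum n k ≡ polyBernoulli n k)
theorem5 (suc n) (suc k) _ _ =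
  ( callanWords
  , callanWords-unique (s≤s z≤n)
  , ∈callanWords⇔IsCallan
  , trans length-callanWords (sym middleSum≡altCounts) )
  , trans (cong +_ (middleSum≡callanCount (suc n) k)) (sym (polyBernoulli≡callanCount (suc n) (suc k)))
  where
  open CallanWords (suc n) (suc k)
  middleSum≡altCounts : middleSum (suc n) (suc k) ≡ altCount (suc n) (suc k) + altCount (suc k) (suc n)
  middleSum≡altCounts = trans (middleSum≡callanCount (suc n) k) (callanCount≡altCount+altCount n (suc k))
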